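{- Let $n\ge 4$ be even and let $\mathcal{L}$ be the special Laplacian matrix of the helm graph $H_n$. Then every cofactor of $\mathcal{L}$ equals $2^{n-3}$.
   Context: Let $m=2n-1$. Notation: $\mathbf{1}$ is the all-ones vector in $\mathbb{R}^{n-1}$, $I$ the $(n-1)\times(n-1)$ identity. For $s=(s_1,\dots,s_\mu)'$, ${\rm Circ}(s')$ is the $\mu\times\mu$ circulant matrix whose first row is $s'$ and each subsequent row is the cyclic right shift of the previous one. For $n$ even and $k\in\{1,\dots,\frac n2-1\}$, let $c^k\in\mathbb{R}^{n-1}$ have $c^k_j=1$ if $j=k+1$ or $j=n-k$, and $c^k_j=0$ otherwise, and let $C_k:={\rm Circ}({c^k}')$. The special Laplacian of $H_n$ is the $m\times m$ matrix \[\mathcal{L} := \frac{1}{2}\begin{bmatrix} n-1 & -\mathbf{1}' & 0\\ -\mathbf{1}& (n+1) I & -2I\\ 0 & -2I & 2I\end{bmatrix}+\sum_{k=1}^{\frac{n}{2}-1}(-1)^{k}\frac{(n-1)-2k}{2}\begin{bmatrix} 0 & 0 & 0\\ 0& C_k & 0\\ 0 & 0 & 0\end{bmatrix},\] with blocks of sizes $1, n-1, n-1$. -}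

module Defs where

open import Data.Nat as ℕ using (ℕ; zero; suc; _∸_; _≤ᵇ_; _≡ᵇ_)
open import Data.Fin using (Fin; toℕ; punchIn) renaming (zero to fzero; suc to fsuc)
open import Data.Integer as ℤ using (ℤ; +_)
open import Data.Rational using (ℚ; _/_; 0ℚ; 1ℚ; _+_; _*_; -_)
open import Data.Bool using (Bool; true; false; if_then_else_; _∧_; _∨_)

Matrix : ℕ → Set
Matrix m = Fin m → Fin m → ℚ

sumFin : (m : ℕ) → (Fin m → ℚ) → ℚ
sumFin zero f = 0ℚ
sumFin (suc m) f = f fzero + sumFin m (λ i → f (fsuc i))

sign : ℕ → ℚ
sign zero = 1ℚ
sign (suc k) = - sign k

minor : {m : ℕ} → Fin (suc m) → Fin (suc m) → Matrix (suc m) → Matrix m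
minor i j A k l = A (punchIn i k) (punchIn j l)

det : (m : ℕ) → Matrix m → ℚ
det zero A = 1ℚ
det (suc m) A = sumFin (suc m) (λ j → (sign (toℕ j) * A fzero j) * det m (minor fzero j A))

cofactor : (m : ℕ) → Matrix m → Fin m → Fin m → ℚ
cofactor (suc m) A i j = sign (toℕ i ℕ.+ toℕ j) * det m (minor i j A)

ℕtoℚ : ℕ → ℚ
ℕtoℚ a = (+ a) / 1

ℤtoℚ : ℤ → ℚ
ℤtoℚ a = a / 1

-- Circ(s') as a μ×μ matrix with 0-based row/column indices r q (< μ);
-- s is the 1-based vector (s_1,…,s_μ). Row r is the r-fold cyclic right
-- shift of s', so entry (r,q) = s_{((q - r) mod μ) + 1}.
circ : (μ : ℕ) → (ℕ → ℚ) → ℕ → ℕ → ℚ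
circ μ s r q = s (suc (if r ≤ᵇ q then q ∸ r else (q ℕ.+ μ) ∸ r))

-- c^k ∈ ℝ^{n-1}, 1-based index j: 1 iff j = k+1 or j = n-k
cvec : (n k : ℕ) → ℕ → ℚ
cvec n k j = if (j ≡ᵇ suc k) ∨ (j ≡ᵇ (n ∸ k)) then 1ℚ else 0ℚ

Cmat : (n k : ℕ) → ℕ → ℕ → ℚ
Cmat n k = circ (n ∸ 1) (cvec n k)

δ : ℕ → ℕ → ℚ
δ a b = if a ≡ᵇ b then 1ℚ else 0ℚ

-- block of a global 0-based index of the m×m matrix (m = 2n-1):
-- block 0 = {0}, block 1 = {1,…,n-1}, block 2 = {n,…,2n-2}
blk : (n i : ℕ) → ℕ
blk n zero = 0
blk n (suc i) = if suc i ≤ᵇ (n ∸ 1) then 1 else 2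

loc : (n i : ℕ) → ℕ
loc n zero = 0
loc n (suc i) = if suc i ≤ᵇ (n ∸ 1) then i else (suc i ∸ n)

-- entries of the block matrix [[n-1, -1', 0], [-1, (n+1)I, -2I], [0, -2I, 2I]]
baseBlock : (n : ℕ) → ℕ → ℕ → ℕ → ℕ → ℚ
baseBlock n 0 0 p q = ℕtoℚ (n ∸ 1)
baseBlock n 0 1 p q = - 1ℚ
baseBlock n 1 0 p q = - 1ℚ
baseBlock n 1 1 p q = ℕtoℚ (suc n) * δ p q
baseBlock n 1 2 p q = ℤtoℚ (ℤ.- (+ 2)) * δ p q
baseBlock n 2 1 p q = ℤtoℚ (ℤ.- (+ 2)) * δ p q
baseBlock n 2 2 p q = ℕtoℚ 2 * δ p q
baseBlock n _ _ p q = 0ℚ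

coeff : (n k : ℕ) → ℚ
coeff n k = sign k * ((+ (n ∸ 1) ℤ.- + (2 ℕ.* k)) / 2)

-- Σ_{k=1}^{n/2-1} coeff n k * C_k (entry p q, local indices in block 1)
circSum : (n : ℕ) → ℕ → ℕ → ℚ
circSum n p q = sumFin (n ℕ./ 2 ∸ 1) (λ k → coeff n (suc (toℕ k)) * Cmat n (suc (toℕ k)) p q)

Lentry : (n i j : ℕ) → ℚ
Lentry n i j =
  ((+ 1 / 2) * baseBlock n (blk n i) (blk n j) (loc n i) (loc n j))
  + (if (blk n i ≡ᵇ 1) ∧ (blk n j ≡ᵇ 1) then circSum n (loc n i) (loc n j) else 0ℚ)

specialLaplacian : (n : ℕ) → Matrix (2 ℕ.* n ∸ 1)
specialLaplacian n i j = Lentry n (toℕ i) (toℕ j)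

-- A symmetric matrix whose rows sum to zero has all its cofactors equal, so it suffices to compute the
-- (hub, hub) cofactor: the determinant of the block [[T, −I], [−I, I]] on the rim and pendant vertices,
-- where T = ((n+1)/2) I + Σ_k coeff_k C_k. Adding the pendant rows to the rim rows reduces it to det (T − I),
-- and T − I is the symmetric Toeplitz matrix with entries (−1)^d (μ − 2d)/2, d = ∣a − b∣, μ = n − 1.
-- Adding to row r twice row r + 1 and once row r + 2 turns its first μ − 2 rows into 2 e_{r+1}, and the
-- remaining 2×2 minor has determinant −1; as μ − 2 is odd, det (T − I) = 2^{μ−2} = 2^{n−3}.

module Submission where

open import Defs
open import Data.Bool using (Bool; true; false; if_then_else_; _∧_; _∨_; T)
open import Data.Empty using (⊥-elim)
open import Data.Fin as F using (Fin; toℕ; punchIn; inject₁; fromℕ; fromℕ<; _↑ˡ_; _↑ʳ_)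
  renaming (zero to fzero; suc to fsuc)
import Data.Fin.Properties as FP
open import Data.Integer as ℤ using (ℤ)
import Data.Integer.Properties as ℤP
import Data.Integer.Solver as ℤSolver
open import Data.Nat as ℕ using (ℕ; zero; suc; _≤_; _<_; z≤n; s≤s; _≤ᵇ_; _≡ᵇ_; ∣_-_∣; _^_; _∸_)
import Data.Nat.Properties as NP
import Data.Nat.DivMod as DM
open import Data.Nat.Divisibility using (_∣_; divides)
open import Data.Product using (Σ; _,_)
open import Data.Rational using (ℚ; 0ℚ; 1ℚ; ½; _+_; _*_; -_; toℚᵘ)
import Data.Rational.Properties as ℚP
open import Data.Rational.Solver using (module +-*-Solver)
open import Data.Rational.Unnormalised as ℚᵘ using (mkℚᵘ; *≡*) renaming (_≃_ to _≃ᵘ_)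
import Data.Rational.Unnormalised.Properties as ℚᵘP
open import Data.Sum using (_⊎_; inj₁; inj₂)
open import Function using (_∘_)
open import Relation.Binary.Definitions using (tri<; tri≈; tri>)
open import Relation.Binary.PropositionalEquality hiding (J)
open import Relation.Nullary using (yes; no)

open +-*-Solver
open ≡-Reasoning
module ℤS = ℤSolver.+-*-Solver

toℚᵘ-ℤtoℚ : (z : ℤ) → toℚᵘ (ℤtoℚ z) ≃ᵘ mkℚᵘ z 0
toℚᵘ-ℤtoℚ z = ℚP.toℚᵘ-fromℚᵘ (mkℚᵘ z 0)

ℤtoℚ-+ : (a b : ℤ) → ℤtoℚ (a ℤ.+ b) ≡ ℤtoℚ a + ℤtoℚ b
ℤtoℚ-+ a b = ℚP.toℚᵘ-injective (ℚᵘP.≃-trans (toℚᵘ-ℤtoℚ (a ℤ.+ b)) (ℚᵘP.≃-trans numerators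
  (ℚᵘP.≃-sym (ℚᵘP.≃-trans (ℚP.toℚᵘ-homo-+ (ℤtoℚ a) (ℤtoℚ b)) (ℚᵘP.+-cong (toℚᵘ-ℤtoℚ a) (toℚᵘ-ℤtoℚ b))))))
  where
  numerators : mkℚᵘ (a ℤ.+ b) 0 ≃ᵘ mkℚᵘ a 0 ℚᵘ.+ mkℚᵘ b 0
  numerators = *≡* (ℤS.solve 2 (λ a b → (a ℤS.:+ b) ℤS.:* ℤS.con (ℤ.+ 1)
    ℤS.:= (a ℤS.:* ℤS.con (ℤ.+ 1) ℤS.:+ b ℤS.:* ℤS.con (ℤ.+ 1)) ℤS.:* ℤS.con (ℤ.+ 1)) refl a b)

ℤtoℚ-* : (a b : ℤ) → ℤtoℚ (a ℤ.* b) ≡ ℤtoℚ a * ℤtoℚ b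
ℤtoℚ-* a b = ℚP.toℚᵘ-injective (ℚᵘP.≃-trans (toℚᵘ-ℤtoℚ (a ℤ.* b)) (ℚᵘP.≃-trans numerators
  (ℚᵘP.≃-sym (ℚᵘP.≃-trans (ℚP.toℚᵘ-homo-* (ℤtoℚ a) (ℤtoℚ b)) (ℚᵘP.*-cong (toℚᵘ-ℤtoℚ a) (toℚᵘ-ℤtoℚ b))))))
  where
  numerators : mkℚᵘ (a ℤ.* b) 0 ≃ᵘ mkℚᵘ a 0 ℚᵘ.* mkℚᵘ b 0
  numerators = *≡* (ℤS.solve 2 (λ a b → (a ℤS.:* b) ℤS.:* ℤS.con (ℤ.+ 1)
    ℤS.:= (a ℤS.:* b) ℤS.:* ℤS.con (ℤ.+ 1)) refl a b)

ℤtoℚ-neg : (a : ℤ) → ℤtoℚ (ℤ.- a) ≡ - ℤtoℚ a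
ℤtoℚ-neg a = ℚP.toℚᵘ-injective (ℚᵘP.≃-trans (toℚᵘ-ℤtoℚ (ℤ.- a))
  (ℚᵘP.≃-sym (ℚᵘP.≃-trans (ℚP.toℚᵘ-homo‿- (ℤtoℚ a)) (ℚᵘP.-‿cong (toℚᵘ-ℤtoℚ a)))))

z/2≡½*z : (z : ℤ) → z Data.Rational./ 2 ≡ ½ * ℤtoℚ z
z/2≡½*z z = ℚP.toℚᵘ-injective (ℚᵘP.≃-trans (ℚP.toℚᵘ-fromℚᵘ (mkℚᵘ z 1)) (ℚᵘP.≃-trans numerators
  (ℚᵘP.≃-sym (ℚᵘP.≃-trans (ℚP.toℚᵘ-homo-* ½ (ℤtoℚ z)) (ℚᵘP.*-cong (ℚP.toℚᵘ-fromℚᵘ (mkℚᵘ (ℤ.+ 1) 1)) (toℚᵘ-ℤtoℚ z))))))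
  where
  numerators : mkℚᵘ z 1 ≃ᵘ mkℚᵘ (ℤ.+ 1) 1 ℚᵘ.* mkℚᵘ z 0
  numerators = *≡* (ℤS.solve 1 (λ z → z ℤS.:* ℤS.con (ℤ.+ 2) ℤS.:= (ℤS.con (ℤ.+ 1) ℤS.:* z) ℤS.:* ℤS.con (ℤ.+ 2)) refl z)

ℕtoℚ-+ : (a b : ℕ) → ℕtoℚ (a ℕ.+ b) ≡ ℕtoℚ a + ℕtoℚ b
ℕtoℚ-+ a b = trans (cong ℤtoℚ (sym (ℤP.pos-+ a b))) (ℤtoℚ-+ (ℤ.+ a) (ℤ.+ b))

ℕtoℚ-* : (a b : ℕ) → ℕtoℚ (a ℕ.* b) ≡ ℕtoℚ a * ℕtoℚ b
ℕtoℚ-* a b = trans (cong ℤtoℚ (ℤP.pos-* a b)) (ℤtoℚ-* (ℤ.+ a) (ℤ.+ b))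

ℕtoℚ-suc : (a : ℕ) → ℕtoℚ (suc a) ≡ 1ℚ + ℕtoℚ a
ℕtoℚ-suc = ℕtoℚ-+ 1

ℕtoℚ-*2 : (a : ℕ) → ℕtoℚ (a ℕ.* 2) ≡ ℕtoℚ a + ℕtoℚ a
ℕtoℚ-*2 a = trans (ℕtoℚ-* a 2) (solve 1 (λ x → x :* (con 1ℚ :+ con 1ℚ) := x :+ x) refl (ℕtoℚ a))

ℕtoℚ-*2+*2 : (a b : ℕ) → ℕtoℚ (a ℕ.* 2 ℕ.+ b ℕ.* 2) ≡ (ℕtoℚ a + ℕtoℚ a) + (ℕtoℚ b + ℕtoℚ b)
ℕtoℚ-*2+*2 a b = trans (ℕtoℚ-+ (a ℕ.* 2) (b ℕ.* 2)) (cong₂ _+_ (ℕtoℚ-*2 a) (ℕtoℚ-*2 b))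

sumFin-cong : (m : ℕ) {f g : Fin m → ℚ} → (∀ i → f i ≡ g i) → sumFin m f ≡ sumFin m g
sumFin-cong zero e = refl
sumFin-cong (suc m) e = cong₂ _+_ (e fzero) (sumFin-cong m (e ∘ fsuc))

sumFin-zero : (m : ℕ) (f : Fin m → ℚ) → (∀ i → f i ≡ 0ℚ) → sumFin m f ≡ 0ℚ
sumFin-zero zero f e = refl
sumFin-zero (suc m) f e = cong₂ _+_ (e fzero) (sumFin-zero m (f ∘ fsuc) (e ∘ fsuc))

sumFin-+ : (m : ℕ) (f g : Fin m → ℚ) → sumFin m (λ i → f i + g i) ≡ sumFin m f + sumFin m g
sumFin-+ zero f g = refl
sumFin-+ (suc m) f g = trans (cong ((f fzero + g fzero) +_) (sumFin-+ m (f ∘ fsuc) (g ∘ fsuc)))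
  (solve 4 (λ a b c d → (a :+ b) :+ (c :+ d) := (a :+ c) :+ (b :+ d)) refl
    (f fzero) (g fzero) (sumFin m (f ∘ fsuc)) (sumFin m (g ∘ fsuc)))

sumFin-*ˡ : (m : ℕ) (c : ℚ) (f : Fin m → ℚ) → sumFin m (λ i → c * f i) ≡ c * sumFin m f
sumFin-*ˡ zero c f = sym (ℚP.*-zeroʳ c)
sumFin-*ˡ (suc m) c f = trans (cong (c * f fzero +_) (sumFin-*ˡ m c (f ∘ fsuc))) (sym (ℚP.*-distribˡ-+ c _ _))

sumFin-neg : (m : ℕ) (f : Fin m → ℚ) → sumFin m (λ i → - f i) ≡ - sumFin m f
sumFin-neg zero f = refl
sumFin-neg (suc m) f = trans (cong (- f fzero +_) (sumFin-neg m (f ∘ fsuc))) (sym (ℚP.neg-distrib-+ (f fzero) _))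

sumFin-linear : (m : ℕ) (x : ℚ) {f g h : Fin m → ℚ} → (∀ j → f j ≡ g j + x * h j) →
  sumFin m f ≡ sumFin m g + x * sumFin m h
sumFin-linear m x {f} {g} {h} e = begin
    sumFin m f                            ≡⟨ sumFin-cong m e ⟩
    sumFin m (λ j → g j + x * h j)        ≡⟨ sumFin-+ m g (λ j → x * h j) ⟩
    sumFin m g + sumFin m (λ j → x * h j) ≡⟨ cong (sumFin m g +_) (sumFin-*ˡ m x h) ⟩
    sumFin m g + x * sumFin m h           ∎

sumFin-swap : (a b : ℕ) (f : Fin a → Fin b → ℚ) →
  sumFin a (λ i → sumFin b (f i)) ≡ sumFin b (λ j → sumFin a (λ i → f i j))
sumFin-swap zero b f = sym (sumFin-zero b _ (λ _ → refl))
sumFin-swap (suc a) b f = trans (cong (sumFin b (f fzero) +_) (sumFin-swap a b (f ∘ fsuc)))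
  (sym (sumFin-+ b (f fzero) _))

sumFin-single : (m : ℕ) (f : Fin m → ℚ) (k : Fin m) → (∀ i → i ≢ k → f i ≡ 0ℚ) → sumFin m f ≡ f k
sumFin-single (suc m) f fzero e =
  trans (cong (f fzero +_) (sumFin-zero m _ (λ i → e (fsuc i) (λ ())))) (ℚP.+-identityʳ _)
sumFin-single (suc m) f (fsuc k) e =
  trans (cong₂ _+_ (e fzero (λ ())) (sumFin-single m (f ∘ fsuc) k (λ i i≢k → e (fsuc i) (i≢k ∘ FP.suc-injective))))
        (ℚP.+-identityˡ _)

sumFin-punchIn : (m : ℕ) (f : Fin (suc m) → ℚ) (i : Fin (suc m)) →
  sumFin (suc m) f ≡ f i + sumFin m (f ∘ punchIn i)
sumFin-punchIn m f fzero = refl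
sumFin-punchIn (suc m) f (fsuc i) = trans (cong (f fzero +_) (sumFin-punchIn m (f ∘ fsuc) i))
  (solve 3 (λ a b c → a :+ (b :+ c) := b :+ (a :+ c)) refl (f fzero) (f (fsuc i)) _)

sumFin-↑ : (a b : ℕ) (f : Fin (a ℕ.+ b) → ℚ) →
  sumFin (a ℕ.+ b) f ≡ sumFin a (λ i → f (i ↑ˡ b)) + sumFin b (λ j → f (a ↑ʳ j))
sumFin-↑ zero b f = sym (ℚP.+-identityˡ _)
sumFin-↑ (suc a) b f = trans (cong (f fzero +_) (sumFin-↑ a b (f ∘ fsuc))) (sym (ℚP.+-assoc (f fzero) _ _))

sumℕ : ℕ → (ℕ → ℚ) → ℚ
sumℕ zero f = 0ℚ
sumℕ (suc m) f = f 0 + sumℕ m (f ∘ suc)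

sumFin-toℕ : (m : ℕ) (f : ℕ → ℚ) → sumFin m (f ∘ toℕ) ≡ sumℕ m f
sumFin-toℕ zero f = refl
sumFin-toℕ (suc m) f = cong (f 0 +_) (sumFin-toℕ m (f ∘ suc))

sumℕ-cong : (m : ℕ) {f g : ℕ → ℚ} → (∀ k → k < m → f k ≡ g k) → sumℕ m f ≡ sumℕ m g
sumℕ-cong zero e = refl
sumℕ-cong (suc m) e = cong₂ _+_ (e 0 (s≤s z≤n)) (sumℕ-cong m (λ k k<m → e (suc k) (s≤s k<m)))

sumℕ-zero : (m : ℕ) (f : ℕ → ℚ) → (∀ k → k < m → f k ≡ 0ℚ) → sumℕ m f ≡ 0ℚ
sumℕ-zero m f e = trans (sumℕ-cong m e) (zeros m)
  where
  zeros : ∀ m → sumℕ m (λ _ → 0ℚ) ≡ 0ℚ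
  zeros zero = refl
  zeros (suc m) = cong (0ℚ +_) (zeros m)

sumℕ-single : (m : ℕ) (f : ℕ → ℚ) (k₀ : ℕ) → k₀ < m → (∀ k → k < m → k ≢ k₀ → f k ≡ 0ℚ) → sumℕ m f ≡ f k₀
sumℕ-single (suc m) f zero _ e =
  trans (cong (f 0 +_) (sumℕ-zero m (f ∘ suc) (λ k k<m → e (suc k) (s≤s k<m) (λ ())))) (ℚP.+-identityʳ _)
sumℕ-single (suc m) f (suc k₀) (s≤s k₀<m) e =
  trans (cong₂ _+_ (e 0 (s≤s z≤n) (λ ()))
                   (sumℕ-single m (f ∘ suc) k₀ k₀<m (λ k k<m k≢k₀ → e (suc k) (s≤s k<m) (k≢k₀ ∘ NP.suc-injective))))
        (ℚP.+-identityˡ _)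

sumℕ-split : (a b : ℕ) (f : ℕ → ℚ) → sumℕ (a ℕ.+ b) f ≡ sumℕ a f + sumℕ b (λ x → f (a ℕ.+ x))
sumℕ-split zero b f = sym (ℚP.+-identityˡ _)
sumℕ-split (suc a) b f = trans (cong (f 0 +_) (sumℕ-split a b (f ∘ suc))) (sym (ℚP.+-assoc (f 0) _ _))

sumℕ-+ : (m : ℕ) (f g : ℕ → ℚ) → sumℕ m (λ k → f k + g k) ≡ sumℕ m f + sumℕ m g
sumℕ-+ zero f g = refl
sumℕ-+ (suc m) f g = trans (cong ((f 0 + g 0) +_) (sumℕ-+ m (f ∘ suc) (g ∘ suc)))
  (solve 4 (λ a b c d → (a :+ b) :+ (c :+ d) := (a :+ c) :+ (b :+ d)) refl (f 0) (g 0) (sumℕ m (f ∘ suc)) (sumℕ m (g ∘ suc)))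

sumℕ-const : (m : ℕ) (c : ℚ) → sumℕ m (λ _ → c) ≡ ℕtoℚ m * c
sumℕ-const zero c = sym (ℚP.*-zeroˡ c)
sumℕ-const (suc m) c = trans (cong (c +_) (sumℕ-const m c))
  (trans (solve 2 (λ c M → c :+ M :* c := (con 1ℚ :+ M) :* c) refl c (ℕtoℚ m)) (cong (_* c) (sym (ℕtoℚ-suc m))))

sumℕ-snoc : (m : ℕ) (f : ℕ → ℚ) → sumℕ (suc m) f ≡ sumℕ m f + f m
sumℕ-snoc zero f = ℚP.+-comm (f 0) 0ℚ
sumℕ-snoc (suc m) f = trans (cong (f 0 +_) (sumℕ-snoc m (f ∘ suc))) (sym (ℚP.+-assoc (f 0) _ _))

sumℕ-reverse : (a : ℕ) (g : ℕ → ℚ) → sumℕ (suc a) (λ b → g (a ∸ b)) ≡ sumℕ (suc a) g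
sumℕ-reverse zero g = refl
sumℕ-reverse (suc a) g = begin
    g (suc a) + sumℕ (suc a) (λ b → g (a ∸ b))
  ≡⟨ cong (g (suc a) +_) (sumℕ-reverse a g) ⟩
    g (suc a) + sumℕ (suc a) g
  ≡⟨ ℚP.+-comm (g (suc a)) _ ⟩
    sumℕ (suc a) g + g (suc a)
  ≡⟨ sym (sumℕ-snoc (suc a) g) ⟩
    sumℕ (suc (suc a)) g ∎

-- Determinants

det-cong : (m : ℕ) {A B : Matrix m} → (∀ i j → A i j ≡ B i j) → det m A ≡ det m B
det-cong zero e = refl
det-cong (suc m) e = sumFin-cong (suc m) (λ j →
  cong₂ _*_ (cong (sign (toℕ j) *_) (e fzero j)) (det-cong m (λ k l → e (punchIn fzero k) (punchIn j l))))

rowTerm : {m : ℕ} → Matrix (suc m) → Fin (suc m) → ℚ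
rowTerm {m} A j = (sign (toℕ j) * A fzero j) * det m (minor fzero j A)

columnTerm : {m : ℕ} → Matrix (suc m) → Fin (suc m) → ℚ
columnTerm {m} A i = (sign (toℕ i) * A i fzero) * det m (minor i fzero A)

-- Expanding by row 0 and then by column 0, or the other way round, gives the same double sum over the minors of A₁₁.
det-columnExpansion : (m : ℕ) (A : Matrix (suc m)) → det (suc m) A ≡ sumFin (suc m) (columnTerm A)
det-columnExpansion zero A = refl
det-columnExpansion (suc m) A = cong (rowTerm A fzero +_) (begin
    sumFin (suc m) (λ j → a j * det (suc m) (minor fzero (fsuc j) A))
  ≡⟨ sumFin-cong (suc m) (λ j → cong (a j *_) (det-columnExpansion m (minor fzero (fsuc j) A))) ⟩
    sumFin (suc m) (λ j → a j * sumFin (suc m) (λ i → b i * det m (minor i j A₁₁)))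
  ≡⟨ sumFin-cong (suc m) (λ j → sym (sumFin-*ˡ (suc m) (a j) (λ i → b i * det m (minor i j A₁₁)))) ⟩
    sumFin (suc m) (λ j → sumFin (suc m) (λ i → a j * (b i * det m (minor i j A₁₁))))
  ≡⟨ sumFin-swap (suc m) (suc m) (λ j i → a j * (b i * det m (minor i j A₁₁))) ⟩
    sumFin (suc m) (λ i → sumFin (suc m) (λ j → a j * (b i * det m (minor i j A₁₁))))
  ≡⟨ sumFin-cong (suc m) (λ i → sumFin-cong (suc m) (λ j →
       solve 5 (λ s a t b d → (:- s :* a) :* ((t :* b) :* d) := (:- t :* b) :* ((s :* a) :* d)) refl
         (sign (toℕ j)) (A fzero (fsuc j)) (sign (toℕ i)) (A (fsuc i) fzero) (det m (minor i j A₁₁)))) ⟩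
    sumFin (suc m) (λ i → sumFin (suc m) (λ j → b′ i * ((sign (toℕ j) * A fzero (fsuc j)) * det m (minor i j A₁₁))))
  ≡⟨ sumFin-cong (suc m) (λ i → sumFin-*ˡ (suc m) (b′ i) (λ j → (sign (toℕ j) * A fzero (fsuc j)) * det m (minor i j A₁₁))) ⟩
    sumFin (suc m) (λ i → b′ i * det (suc m) (minor (fsuc i) fzero A)) ∎)
  where
  A₁₁ = minor fzero fzero A
  a b′ : Fin (suc m) → ℚ
  a j = - sign (toℕ j) * A fzero (fsuc j)
  b′ i = - sign (toℕ i) * A (fsuc i) fzero
  b : Fin (suc m) → ℚ
  b i = sign (toℕ i) * A (fsuc i) fzero

det-transpose : (m : ℕ) (A : Matrix m) → det m (λ i j → A j i) ≡ det m A
det-transpose zero A = refl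
det-transpose (suc m) A = trans
  (sumFin-cong (suc m) (λ j → cong ((sign (toℕ j) * A j fzero) *_) (det-transpose m (minor j fzero A))))
  (sym (det-columnExpansion m A))

det-rowLinear : (m : ℕ) (r : Fin m) (x : ℚ) (A B C : Matrix m) →
  (∀ i → i ≢ r → ∀ j → C i j ≡ A i j) → (∀ i → i ≢ r → ∀ j → C i j ≡ B i j) →
  (∀ j → C r j ≡ A r j + x * B r j) → det m C ≡ det m A + x * det m B
det-rowLinear (suc m) fzero x A B C eA eB er = sumFin-linear (suc m) x {g = rowTerm A} {h = rowTerm B} λ j → begin
    (sign (toℕ j) * C fzero j) * det m (minor fzero j C)
  ≡⟨ cong (λ u → (sign (toℕ j) * u) * det m (minor fzero j C)) (er j) ⟩
    (sign (toℕ j) * (A fzero j + x * B fzero j)) * det m (minor fzero j C)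
  ≡⟨ solve 5 (λ s a x b d → (s :* (a :+ x :* b)) :* d := (s :* a) :* d :+ x :* ((s :* b) :* d)) refl
       (sign (toℕ j)) (A fzero j) x (B fzero j) (det m (minor fzero j C)) ⟩
    (sign (toℕ j) * A fzero j) * det m (minor fzero j C) + x * ((sign (toℕ j) * B fzero j) * det m (minor fzero j C))
  ≡⟨ cong₂ (λ u v → (sign (toℕ j) * A fzero j) * u + x * ((sign (toℕ j) * B fzero j) * v))
       (det-cong m (λ k l → eA (fsuc k) (λ ()) (punchIn j l))) (det-cong m (λ k l → eB (fsuc k) (λ ()) (punchIn j l))) ⟩
    rowTerm A j + x * rowTerm B j ∎
det-rowLinear (suc m) (fsuc r) x A B C eA eB er = sumFin-linear (suc m) x {g = rowTerm A} {h = rowTerm B} λ j → begin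
    (sign (toℕ j) * C fzero j) * det m (minor fzero j C)
  ≡⟨ cong ((sign (toℕ j) * C fzero j) *_) (det-rowLinear m r x (minor fzero j A) (minor fzero j B) (minor fzero j C)
       (λ i i≢r l → eA (fsuc i) (i≢r ∘ FP.suc-injective) (punchIn j l))
       (λ i i≢r l → eB (fsuc i) (i≢r ∘ FP.suc-injective) (punchIn j l))
       (λ l → er (punchIn j l))) ⟩
    (sign (toℕ j) * C fzero j) * (det m (minor fzero j A) + x * det m (minor fzero j B))
  ≡⟨ solve 5 (λ s c x a b → (s :* c) :* (a :+ x :* b) := (s :* c) :* a :+ x :* ((s :* c) :* b)) refl
       (sign (toℕ j)) (C fzero j) x (det m (minor fzero j A)) (det m (minor fzero j B)) ⟩
    (sign (toℕ j) * C fzero j) * det m (minor fzero j A) + x * ((sign (toℕ j) * C fzero j) * det m (minor fzero j B))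
  ≡⟨ cong₂ (λ u v → (sign (toℕ j) * u) * det m (minor fzero j A) + x * ((sign (toℕ j) * v) * det m (minor fzero j B)))
       (eA fzero (λ ()) j) (eB fzero (λ ()) j) ⟩
    rowTerm A j + x * rowTerm B j ∎

-- In the column expansion the first two terms trade places; that the other terms flip sign is assumed
-- here and supplied by the recursion in det-swapFirstRows.
det-swapFirstRows′ : (m : ℕ) (A B : Matrix (suc (suc m))) →
  (∀ j → B fzero j ≡ A (fsuc fzero) j) → (∀ j → B (fsuc fzero) j ≡ A fzero j) →
  (∀ i j → B (fsuc (fsuc i)) j ≡ A (fsuc (fsuc i)) j) →
  (∀ i → columnTerm B (fsuc (fsuc i)) ≡ - columnTerm A (fsuc (fsuc i))) →
  det (suc (suc m)) B ≡ - det (suc (suc m)) A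
det-swapFirstRows′ m A B e₀ e₁ e₂ rest = begin
    det (suc (suc m)) B
  ≡⟨ det-columnExpansion (suc m) B ⟩
    columnTerm B fzero + (columnTerm B (fsuc fzero) + sumFin m (columnTerm B ∘ fsuc ∘ fsuc))
  ≡⟨ cong₂ (λ u v → u + (v + sumFin m (columnTerm B ∘ fsuc ∘ fsuc))) term₀ term₁ ⟩
    (1ℚ * a₁) * d₁ + ((- 1ℚ * a₀) * d₀ + sumFin m (columnTerm B ∘ fsuc ∘ fsuc))
  ≡⟨ cong (λ u → (1ℚ * a₁) * d₁ + ((- 1ℚ * a₀) * d₀ + u)) (trans (sumFin-cong m rest) (sumFin-neg m (columnTerm A ∘ fsuc ∘ fsuc))) ⟩
    (1ℚ * a₁) * d₁ + ((- 1ℚ * a₀) * d₀ + - sumFin m (columnTerm A ∘ fsuc ∘ fsuc))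
  ≡⟨ solve 5 (λ a₀ d₀ a₁ d₁ r → (con 1ℚ :* a₁) :* d₁ :+ ((:- con 1ℚ :* a₀) :* d₀ :+ :- r)
                               := :- ((con 1ℚ :* a₀) :* d₀ :+ ((:- con 1ℚ :* a₁) :* d₁ :+ r))) refl
       a₀ d₀ a₁ d₁ (sumFin m (columnTerm A ∘ fsuc ∘ fsuc)) ⟩
    - (columnTerm A fzero + (columnTerm A (fsuc fzero) + sumFin m (columnTerm A ∘ fsuc ∘ fsuc)))
  ≡⟨ cong -_ (sym (det-columnExpansion (suc m) A)) ⟩
    - det (suc (suc m)) A ∎
  where
  a₀ = A fzero fzero
  a₁ = A (fsuc fzero) fzero
  d₀ = det (suc m) (minor fzero fzero A)
  d₁ = det (suc m) (minor (fsuc fzero) fzero A)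
  term₀ : columnTerm B fzero ≡ (1ℚ * a₁) * d₁
  term₀ = cong₂ (λ u v → (1ℚ * u) * v) (e₀ fzero)
            (det-cong (suc m) {minor fzero fzero B} {minor (fsuc fzero) fzero A} (λ { fzero l → e₁ (fsuc l) ; (fsuc k) l → e₂ k (fsuc l) }))
  term₁ : columnTerm B (fsuc fzero) ≡ (- 1ℚ * a₀) * d₀
  term₁ = cong₂ (λ u v → (- 1ℚ * u) * v) (e₁ fzero)
            (det-cong (suc m) {minor (fsuc fzero) fzero B} {minor fzero fzero A} (λ { fzero l → e₀ (fsuc l) ; (fsuc k) l → e₂ k (fsuc l) }))

det-swapFirstRows : (m : ℕ) (A B : Matrix (suc (suc m))) →
  (∀ j → B fzero j ≡ A (fsuc fzero) j) → (∀ j → B (fsuc fzero) j ≡ A fzero j) →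
  (∀ i j → B (fsuc (fsuc i)) j ≡ A (fsuc (fsuc i)) j) →
  det (suc (suc m)) B ≡ - det (suc (suc m)) A
det-swapFirstRows zero A B e₀ e₁ e₂ = det-swapFirstRows′ zero A B e₀ e₁ e₂ (λ ())
det-swapFirstRows (suc m) A B e₀ e₁ e₂ = det-swapFirstRows′ (suc m) A B e₀ e₁ e₂ λ i →
  trans (cong₂ (λ u v → (sign (toℕ (fsuc (fsuc i))) * u) * v) (e₂ i fzero)
          (det-swapFirstRows m (minor (fsuc (fsuc i)) fzero A) (minor (fsuc (fsuc i)) fzero B)
            (λ l → e₀ (fsuc l)) (λ l → e₁ (fsuc l)) (λ k l → e₂ (punchIn i k) (fsuc l))))
        (sym (ℚP.neg-distribʳ-* (sign (toℕ (fsuc (fsuc i))) * A (fsuc (fsuc i)) fzero)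
                                 (det (suc (suc m)) (minor (fsuc (fsuc i)) fzero A))))

det-swapAdjacentRows : (m : ℕ) (r : Fin (suc m)) (A B : Matrix (suc (suc m))) →
  (∀ j → B (inject₁ r) j ≡ A (fsuc r) j) → (∀ j → B (fsuc r) j ≡ A (inject₁ r) j) →
  (∀ i → i ≢ inject₁ r → i ≢ fsuc r → ∀ j → B i j ≡ A i j) →
  det (suc (suc m)) B ≡ - det (suc (suc m)) A
det-swapAdjacentRows m fzero A B e₀ e₁ e = det-swapFirstRows m A B e₀ e₁ (λ i → e (fsuc (fsuc i)) (λ ()) (λ ()))
det-swapAdjacentRows (suc m) (fsuc r) A B e₀ e₁ e = trans
  (sumFin-cong (suc (suc (suc m))) λ j → trans
     (cong₂ (λ u v → (sign (toℕ j) * u) * v) (e fzero (λ ()) (λ ()) j)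
        (det-swapAdjacentRows m r (minor fzero j A) (minor fzero j B)
           (λ l → e₀ (punchIn j l)) (λ l → e₁ (punchIn j l))
           (λ i i≢r i≢r+1 l → e (fsuc i) (i≢r ∘ FP.suc-injective) (i≢r+1 ∘ FP.suc-injective) (punchIn j l))))
     (sym (ℚP.neg-distribʳ-* (sign (toℕ j) * A fzero j) (det (suc (suc m)) (minor fzero j A)))))
  (sumFin-neg (suc (suc (suc m))) (rowTerm A))

x≡-x⇒x≡0 : (x : ℚ) → x ≡ - x → x ≡ 0ℚ
x≡-x⇒x≡0 x x≡-x = begin
  x               ≡⟨ solve 1 (λ x → x := con ½ :* (x :+ x)) refl x ⟩
  ½ * (x + x)     ≡⟨ cong (λ u → ½ * (x + u)) x≡-x ⟩
  ½ * (x + - x)   ≡⟨ solve 1 (λ x → con ½ :* (x :+ :- x) := con 0ℚ) refl x ⟩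
  0ℚ              ∎

swapRows : {m : ℕ} (u v : Fin m) → Matrix m → Matrix m
swapRows u v A i j with i FP.≟ u | i FP.≟ v
... | yes _ | _     = A v j
... | no _  | yes _ = A u j
... | no _  | no _  = A i j

swapRows-first : {m : ℕ} (u v : Fin m) (A : Matrix m) (j : Fin m) → swapRows u v A u j ≡ A v j
swapRows-first u v A j with u FP.≟ u
... | yes _ = refl
... | no u≢u = ⊥-elim (u≢u refl)

swapRows-second : {m : ℕ} (u v : Fin m) (A : Matrix m) (j : Fin m) → u ≢ v → swapRows u v A v j ≡ A u j
swapRows-second u v A j u≢v with v FP.≟ u | v FP.≟ v
... | yes v≡u | _ = ⊥-elim (u≢v (sym v≡u))
... | no _ | yes _ = refl
... | no _ | no v≢v = ⊥-elim (v≢v refl)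

swapRows-other : {m : ℕ} (u v : Fin m) (A : Matrix m) (i j : Fin m) → i ≢ u → i ≢ v → swapRows u v A i j ≡ A i j
swapRows-other u v A i j i≢u i≢v with i FP.≟ u | i FP.≟ v
... | yes i≡u | _ = ⊥-elim (i≢u i≡u)
... | no _ | yes i≡v = ⊥-elim (i≢v i≡v)
... | no _ | no _ = refl

inject₁≢suc : {m : ℕ} (c : Fin m) → inject₁ c ≢ fsuc c
inject₁≢suc c e = NP.1+n≢n (sym (trans (sym (FP.toℕ-inject₁ c)) (cong toℕ e)))

-- Swapping row b with the row above it brings the two equal rows closer and only flips the sign.
det-equalRows-at : (k m : ℕ) (A : Matrix m) (a b : Fin m) → toℕ b ≡ suc (toℕ a ℕ.+ k) →
  (∀ j → A a j ≡ A b j) → det m A ≡ 0ℚ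
det-equalRows-at k (suc m) A a fzero () eq
det-equalRows-at k (suc zero) A a (fsuc ()) b≡a+k+1 eq
det-equalRows-at zero (suc (suc m)) A a (fsuc c) b≡a+1 eq =
  x≡-x⇒x≡0 _ (det-swapAdjacentRows m c A A (λ j → rows j) (λ j → sym (rows j)) (λ _ _ _ _ → refl))
  where
  c≡a : inject₁ c ≡ a
  c≡a = FP.toℕ-injective (trans (FP.toℕ-inject₁ c) (trans (NP.suc-injective b≡a+1) (NP.+-identityʳ _)))
  rows : ∀ j → A (inject₁ c) j ≡ A (fsuc c) j
  rows j = trans (cong (λ x → A x j) c≡a) (eq j)
det-equalRows-at (suc k) (suc (suc m)) A a (fsuc c) b≡a+k+2 eq = begin
    det (suc (suc m)) A   ≡⟨ solve 1 (λ d → d := :- (:- d)) refl (det (suc (suc m)) A) ⟩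
    - (- det _ A)         ≡⟨ cong -_ (sym detB≡-detA) ⟩
    - det _ B             ≡⟨ cong -_ detB≡0 ⟩
    - 0ℚ                  ∎
  where
  B = swapRows (inject₁ c) (fsuc c) A
  c≡a+k+1 : toℕ c ≡ suc (toℕ a ℕ.+ k)
  c≡a+k+1 = trans (NP.suc-injective b≡a+k+2) (NP.+-suc (toℕ a) k)
  a≢c : a ≢ inject₁ c
  a≢c e = NP.m≢1+m+n (toℕ a) (trans (trans (cong toℕ e) (FP.toℕ-inject₁ c)) c≡a+k+1)
  a≢c+1 : a ≢ fsuc c
  a≢c+1 e = NP.<⇒≢ (NP.≤-trans (s≤s (NP.m≤m+n (toℕ a) k))
                     (NP.≤-trans (NP.≤-reflexive (sym c≡a+k+1)) (NP.n≤1+n _))) (cong toℕ e)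
  detB≡-detA : det (suc (suc m)) B ≡ - det (suc (suc m)) A
  detB≡-detA = det-swapAdjacentRows m c A B (swapRows-first (inject₁ c) (fsuc c) A)
    (λ j → swapRows-second (inject₁ c) (fsuc c) A j (inject₁≢suc c))
    (λ i i≢c i≢c+1 j → swapRows-other (inject₁ c) (fsuc c) A i j i≢c i≢c+1)
  detB≡0 : det (suc (suc m)) B ≡ 0ℚ
  detB≡0 = det-equalRows-at k (suc (suc m)) B a (inject₁ c) (trans (FP.toℕ-inject₁ c) c≡a+k+1)
    (λ j → trans (swapRows-other (inject₁ c) (fsuc c) A a j a≢c a≢c+1)
             (trans (eq j) (sym (swapRows-first (inject₁ c) (fsuc c) A j))))

det-equalRows : (m : ℕ) (A : Matrix m) (a b : Fin m) → a ≢ b → (∀ j → A a j ≡ A b j) → det m A ≡ 0ℚ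
det-equalRows m A a b a≢b eq with NP.<-cmp (toℕ a) (toℕ b)
... | tri< a<b _ _ = det-equalRows-at (toℕ b ∸ suc (toℕ a)) m A a b (sym (NP.m+[n∸m]≡n a<b)) eq
... | tri≈ _ a≡b _ = ⊥-elim (a≢b (FP.toℕ-injective a≡b))
... | tri> _ _ b<a = det-equalRows-at (toℕ a ∸ suc (toℕ b)) m A b a (sym (NP.m+[n∸m]≡n b<a)) (λ j → sym (eq j))

replaceRow : {m : ℕ} (r : Fin m) (v : Fin m → ℚ) → Matrix m → Matrix m
replaceRow r v A i j with i FP.≟ r
... | yes _ = v j
... | no _ = A i j

replaceRow-≡ : {m : ℕ} (r : Fin m) (v : Fin m → ℚ) (A : Matrix m) (j : Fin m) → replaceRow r v A r j ≡ v j
replaceRow-≡ r v A j with r FP.≟ r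
... | yes _ = refl
... | no r≢r = ⊥-elim (r≢r refl)

replaceRow-≢ : {m : ℕ} (r : Fin m) (v : Fin m → ℚ) (A : Matrix m) (i j : Fin m) → i ≢ r → replaceRow r v A i j ≡ A i j
replaceRow-≢ r v A i j i≢r with i FP.≟ r
... | yes i≡r = ⊥-elim (i≢r i≡r)
... | no _ = refl

det-zeroRow : (m : ℕ) (A : Matrix m) (r : Fin m) → (∀ j → A r j ≡ 0ℚ) → det m A ≡ 0ℚ
det-zeroRow m A r zero-row = begin
    det m A                               ≡⟨ solve 1 (λ d → d := (d :+ con 1ℚ :* d) :+ :- d) refl (det m A) ⟩
    (det m A + 1ℚ * det m A) + - det m A  ≡⟨ cong (_+ - det m A) (sym (det-rowLinear m r 1ℚ A A A
                                               (λ _ _ _ → refl) (λ _ _ _ → refl) doubled)) ⟩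
    det m A + - det m A                   ≡⟨ ℚP.+-inverseʳ (det m A) ⟩
    0ℚ                                    ∎
  where
  doubled : ∀ j → A r j ≡ A r j + 1ℚ * A r j
  doubled j = trans (zero-row j) (sym (cong₂ (λ u v → u + 1ℚ * v) (zero-row j) (zero-row j)))

det-addRowMultiple : (m : ℕ) (r s : Fin m) (x : ℚ) (A C : Matrix m) → r ≢ s →
  (∀ i → i ≢ r → ∀ j → C i j ≡ A i j) → (∀ j → C r j ≡ A r j + x * A s j) → det m C ≡ det m A
det-addRowMultiple m r s x A C r≢s others row-r = begin
    det m C             ≡⟨ det-rowLinear m r x A B C others (λ i i≢r j → trans (others i i≢r j) (sym (replaceRow-≢ r (A s) A i j i≢r)))
                             (λ j → trans (row-r j) (cong (λ u → A r j + x * u) (sym (replaceRow-≡ r (A s) A j)))) ⟩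
    det m A + x * det m B ≡⟨ cong (λ u → det m A + x * u) (det-equalRows m B r s r≢s
                               (λ j → trans (replaceRow-≡ r (A s) A j) (sym (replaceRow-≢ r (A s) A s j (r≢s ∘ sym))))) ⟩
    det m A + x * 0ℚ    ≡⟨ solve 2 (λ a x → a :+ x :* con 0ℚ := a) refl (det m A) x ⟩
    det m A             ∎
  where
  B = replaceRow r (A s) A

det-addRowCombination : (m : ℕ) (r : Fin m) (N : ℕ) (g : Fin N → Fin m) (c : Fin N → ℚ) → (∀ k → g k ≢ r) →
  (A C : Matrix m) → (∀ i → i ≢ r → ∀ j → C i j ≡ A i j) →
  (∀ j → C r j ≡ A r j + sumFin N (λ k → c k * A (g k) j)) → det m C ≡ det m A
det-addRowCombination m r zero g c g≢r A C others row-r = det-cong m C≡A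
  where
  C≡A : ∀ i j → C i j ≡ A i j
  C≡A i j with i FP.≟ r
  ... | yes refl = trans (row-r j) (ℚP.+-identityʳ _)
  ... | no i≢r = others i i≢r j
det-addRowCombination m r (suc N) g c g≢r A C others row-r = trans step
  (det-addRowCombination m r N (g ∘ fsuc) (c ∘ fsuc) (g≢r ∘ fsuc) A C′ (λ i i≢r j → replaceRow-≢ r v A i j i≢r) (replaceRow-≡ r v A))
  where
  v : Fin m → ℚ
  v j = A r j + sumFin N (λ k → c (fsuc k) * A (g (fsuc k)) j)
  C′ = replaceRow r v A
  step : det m C ≡ det m C′
  step = det-addRowMultiple m r (g fzero) (c fzero) C′ C (g≢r fzero ∘ sym)
    (λ i i≢r j → trans (others i i≢r j) (sym (replaceRow-≢ r v A i j i≢r)))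
    (λ j → trans (row-r j) (trans
       (solve 4 (λ a x b s → a :+ (x :* b :+ s) := (a :+ s) :+ x :* b) refl (A r j) (c fzero) (A (g fzero) j) _)
       (cong₂ (λ u w → u + c fzero * w) (sym (replaceRow-≡ r v A j)) (sym (replaceRow-≢ r v A (g fzero) j (g≢r fzero))))))

det-scaleRow : (m : ℕ) (r : Fin m) (x : ℚ) (B C : Matrix m) →
  (∀ i → i ≢ r → ∀ j → C i j ≡ B i j) → (∀ j → C r j ≡ x * B r j) → det m C ≡ x * det m B
det-scaleRow m r x B C others row-r = begin
    det m C                ≡⟨ det-rowLinear m r x Z B C
                                (λ i i≢r j → trans (others i i≢r j) (sym (replaceRow-≢ r (λ _ → 0ℚ) B i j i≢r))) others
                                (λ j → trans (row-r j) (trans (sym (ℚP.+-identityˡ _))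
                                  (cong (_+ x * B r j) (sym (replaceRow-≡ r (λ _ → 0ℚ) B j))))) ⟩
    det m Z + x * det m B  ≡⟨ cong (_+ x * det m B) (det-zeroRow m Z r (replaceRow-≡ r (λ _ → 0ℚ) B)) ⟩
    0ℚ + x * det m B       ≡⟨ ℚP.+-identityˡ _ ⟩
    x * det m B            ∎
  where
  Z = replaceRow r (λ _ → 0ℚ) B

-- Cofactors

Symmetric : {m : ℕ} → Matrix m → Set
Symmetric A = ∀ i j → A i j ≡ A j i

ColumnSumsZero : {m : ℕ} → Matrix m → Set
ColumnSumsZero {m} A = ∀ c → sumFin m (λ r → A r c) ≡ 0ℚ

punchIn-inject₁≡punchIn-suc : {m : ℕ} (i k : Fin m) → k ≢ i → punchIn (inject₁ i) k ≡ punchIn (fsuc i) k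
punchIn-inject₁≡punchIn-suc fzero fzero k≢i = ⊥-elim (k≢i refl)
punchIn-inject₁≡punchIn-suc fzero (fsuc k) k≢i = refl
punchIn-inject₁≡punchIn-suc (fsuc i) fzero k≢i = refl
punchIn-inject₁≡punchIn-suc (fsuc i) (fsuc k) k≢i = cong fsuc (punchIn-inject₁≡punchIn-suc i k (k≢i ∘ cong fsuc))

punchIn-suc-self : {m : ℕ} (i : Fin m) → punchIn (fsuc i) i ≡ inject₁ i
punchIn-suc-self fzero = refl
punchIn-suc-self (fsuc i) = cong fsuc (punchIn-suc-self i)

-- The minors P (row i deleted) and Q (row i+1 deleted) differ only in their row i. Adding to that row of P
-- all its other rows turns it, by the zero column sums, into minus that row of Q.
det-minor-adjacentRows : (m : ℕ) (A : Matrix (suc (suc m))) → ColumnSumsZero A → (i : Fin (suc m)) (j : Fin (suc (suc m))) →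
  det (suc m) (minor (inject₁ i) j A) ≡ - det (suc m) (minor (fsuc i) j A)
det-minor-adjacentRows m A columns i j = begin
    det (suc m) P                ≡⟨ sym (det-addRowCombination (suc m) i m (punchIn i) (λ _ → 1ℚ) (FP.punchInᵢ≢i i) P P′
                                      (λ k k≢i l → replaceRow-≢ i v P k l k≢i) (λ l → trans (replaceRow-≡ i v P l) (sym (rowSum l)))) ⟩
    det (suc m) P′               ≡⟨ det-scaleRow (suc m) i (- 1ℚ) Q P′
                                      (λ k k≢i l → trans (replaceRow-≢ i v P k l k≢i)
                                                     (cong (λ x → A x (punchIn j l)) (punchIn-inject₁≡punchIn-suc i k k≢i)))
                                      (λ l → trans (replaceRow-≡ i v P l) (solve 1 (λ q → :- q := :- con 1ℚ :* q) refl (Q i l))) ⟩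
    - 1ℚ * det (suc m) Q         ≡⟨ solve 1 (λ d → :- con 1ℚ :* d := :- d) refl (det (suc m) Q) ⟩
    - det (suc m) Q              ∎
  where
  P = minor (inject₁ i) j A
  Q = minor (fsuc i) j A
  v : Fin (suc m) → ℚ
  v l = - Q i l
  P′ = replaceRow i v P
  rowSum : ∀ l → P i l + sumFin m (λ k → 1ℚ * P (punchIn i k) l) ≡ v l
  rowSum l = begin
      P i l + sumFin m (λ k → 1ℚ * P (punchIn i k) l)
    ≡⟨ cong (P i l +_) (sumFin-cong m (λ k → ℚP.*-identityˡ _)) ⟩
      P i l + sumFin m (λ k → P (punchIn i k) l)
    ≡⟨ sym (sumFin-punchIn m (λ k → P k l) i) ⟩
      sumFin (suc m) (λ k → P k l)
    ≡⟨ solve 2 (λ a s → s := (a :+ s) :+ :- a) refl (A (inject₁ i) (punchIn j l)) _ ⟩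
      (A (inject₁ i) (punchIn j l) + sumFin (suc m) (λ k → P k l)) + - A (inject₁ i) (punchIn j l)
    ≡⟨ cong (_+ - A (inject₁ i) (punchIn j l))
         (trans (sym (sumFin-punchIn (suc m) (λ r → A r (punchIn j l)) (inject₁ i))) (columns (punchIn j l))) ⟩
      0ℚ + - A (inject₁ i) (punchIn j l)
    ≡⟨ ℚP.+-identityˡ _ ⟩
      - A (inject₁ i) (punchIn j l)
    ≡⟨ cong (λ x → - A x (punchIn j l)) (sym (punchIn-suc-self i)) ⟩
      v l ∎

cofactor-adjacentRows : (m : ℕ) (A : Matrix (suc m)) → ColumnSumsZero A →
  (i : Fin m) (j : Fin (suc m)) → cofactor (suc m) A (inject₁ i) j ≡ cofactor (suc m) A (fsuc i) j
cofactor-adjacentRows (suc m) A columns i j = begin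
    sign (toℕ (inject₁ i) ℕ.+ toℕ j) * det (suc m) (minor (inject₁ i) j A)
  ≡⟨ cong₂ (λ u v → sign (u ℕ.+ toℕ j) * v) (FP.toℕ-inject₁ i) (det-minor-adjacentRows m A columns i j) ⟩
    sign (toℕ i ℕ.+ toℕ j) * - det (suc m) (minor (fsuc i) j A)
  ≡⟨ solve 2 (λ s d → s :* :- d := :- s :* d) refl (sign (toℕ i ℕ.+ toℕ j)) (det (suc m) (minor (fsuc i) j A)) ⟩
    sign (suc (toℕ i) ℕ.+ toℕ j) * det (suc m) (minor (fsuc i) j A) ∎

cofactor≡cofactor-firstRow : (m : ℕ) (A : Matrix (suc m)) → ColumnSumsZero A →
  (k : ℕ) (i j : Fin (suc m)) → toℕ i ≡ k → cofactor (suc m) A i j ≡ cofactor (suc m) A fzero j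
cofactor≡cofactor-firstRow m A columns k fzero j _ = refl
cofactor≡cofactor-firstRow (suc m) A columns (suc k) (fsuc i) j i+1≡k+1 =
  trans (sym (cofactor-adjacentRows (suc m) A columns i j))
        (cofactor≡cofactor-firstRow (suc m) A columns k (inject₁ i) j (trans (FP.toℕ-inject₁ i) (NP.suc-injective i+1≡k+1)))

cofactor-sym : (m : ℕ) (A : Matrix (suc m)) → Symmetric A → (i j : Fin (suc m)) →
  cofactor (suc m) A i j ≡ cofactor (suc m) A j i
cofactor-sym m A sym-A i j = cong₂ _*_ (cong sign (NP.+-comm (toℕ i) (toℕ j)))
  (trans (sym (det-transpose m (minor i j A))) (det-cong m (λ k l → sym-A (punchIn i l) (punchIn j k))))

cofactor≡cofactor₀₀ : (m : ℕ) (A : Matrix (suc m)) → Symmetric A → ColumnSumsZero A →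
  (i j : Fin (suc m)) → cofactor (suc m) A i j ≡ cofactor (suc m) A fzero fzero
cofactor≡cofactor₀₀ m A sym-A columns i j = begin
  cofactor (suc m) A i j         ≡⟨ cofactor≡cofactor-firstRow m A columns (toℕ i) i j refl ⟩
  cofactor (suc m) A fzero j     ≡⟨ cofactor-sym m A sym-A fzero j ⟩
  cofactor (suc m) A j fzero     ≡⟨ cofactor≡cofactor-firstRow m A columns (toℕ j) j fzero refl ⟩
  cofactor (suc m) A fzero fzero ∎

T⇒≡true : {b : Bool} → T b → b ≡ true
T⇒≡true {true} _ = refl

≡ᵇ-≡ : {a b : ℕ} → a ≡ b → (a ≡ᵇ b) ≡ true
≡ᵇ-≡ {a} refl = T⇒≡true (NP.≡⇒≡ᵇ a a refl)

≡ᵇ-≢ : {a b : ℕ} → a ≢ b → (a ≡ᵇ b) ≡ false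
≡ᵇ-≢ {a} {b} a≢b with a ≡ᵇ b in eq
... | true = ⊥-elim (a≢b (NP.≡ᵇ⇒≡ a b (subst T (sym eq) _)))
... | false = refl

δ-≡ : (a : ℕ) → δ a a ≡ 1ℚ
δ-≡ a = cong (if_then 1ℚ else 0ℚ) (≡ᵇ-≡ {a} refl)

δ-≢ : {a b : ℕ} → a ≢ b → δ a b ≡ 0ℚ
δ-≢ a≢b = cong (if_then 1ℚ else 0ℚ) (≡ᵇ-≢ a≢b)

spliceRows : {m : ℕ} (K : ℕ) → Matrix m → Matrix m → Matrix m
spliceRows K X Y r j with toℕ r NP.<? K
... | yes _ = X r j
... | no _ = Y r j

spliceRows-< : {m : ℕ} (K : ℕ) (X Y : Matrix m) (r j : Fin m) → toℕ r < K → spliceRows K X Y r j ≡ X r j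
spliceRows-< K X Y r j r<K with toℕ r NP.<? K
... | yes _ = refl
... | no r≮K = ⊥-elim (r≮K r<K)

spliceRows-≥ : {m : ℕ} (K : ℕ) (X Y : Matrix m) (r j : Fin m) → K ≤ toℕ r → spliceRows K X Y r j ≡ Y r j
spliceRows-≥ K X Y r j K≤r with toℕ r NP.<? K
... | yes r<K = ⊥-elim (NP.<⇒≱ r<K K≤r)
... | no _ = refl

-- A unitriangular change of the first K rows. The changed rows are undone from the last one upwards, so the
-- rows added to the one being undone are still original.
det-addLaterRows : (m N K : ℕ) (g : Fin m → Fin N → Fin m) (c : Fin m → Fin N → ℚ) (A B : Matrix m) →
  (∀ r k → toℕ r < K → toℕ r < toℕ (g r k)) →
  (∀ r j → toℕ r < K → B r j ≡ A r j + sumFin N (λ k → c r k * A (g r k) j)) →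
  (∀ r j → K ≤ toℕ r → B r j ≡ A r j) → det m B ≡ det m A
det-addLaterRows m N zero g c A B g-later upper lower = det-cong m (λ r j → lower r j z≤n)
det-addLaterRows m N (suc K) g c A B g-later upper lower = trans detB≡detB′
  (det-addLaterRows m N K g c A B′ (λ r k r<K → g-later r k (NP.m<n⇒m<1+n r<K))
    (spliceRows-< K X A) (spliceRows-≥ K X A))
  where
  X : Matrix m
  X r j = A r j + sumFin N (λ k → c r k * A (g r k) j)
  B′ = spliceRows K X A
  detB≡detB′ : det m B ≡ det m B′
  detB≡detB′ with K NP.<? m
  ... | no K≮m = det-cong m (λ r j → trans (upper r j (NP.m<n⇒m<1+n (r<K r))) (sym (spliceRows-< K X A r j (r<K r))))
    where
    r<K : (r : Fin m) → toℕ r < K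
    r<K r = NP.<-≤-trans (FP.toℕ<n r) (NP.≮⇒≥ K≮m)
  ... | yes K<m = det-addRowCombination m r₀ N (g r₀) (c r₀) g≢r₀ B′ B others row-r₀
    where
    r₀ = fromℕ< K<m
    r₀≡K : toℕ r₀ ≡ K
    r₀≡K = FP.toℕ-fromℕ< K<m
    r₀<g : ∀ k → toℕ r₀ < toℕ (g r₀ k)
    r₀<g k = g-later r₀ k (NP.≤-reflexive (cong suc r₀≡K))
    g≢r₀ : ∀ k → g r₀ k ≢ r₀
    g≢r₀ k e = NP.<-irrefl (cong toℕ (sym e)) (r₀<g k)
    others : ∀ i → i ≢ r₀ → ∀ j → B i j ≡ B′ i j
    others i i≢r₀ j with NP.≤-<-connex K (toℕ i)
    ... | inj₂ i<K = trans (upper i j (NP.m<n⇒m<1+n i<K)) (sym (spliceRows-< K X A i j i<K))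
    ... | inj₁ K≤i = trans (lower i j (NP.≤∧≢⇒< K≤i (λ e → i≢r₀ (FP.toℕ-injective (trans (sym e) (sym r₀≡K))))))
                           (sym (spliceRows-≥ K X A i j K≤i))
    row-r₀ : ∀ j → B r₀ j ≡ B′ r₀ j + sumFin N (λ k → c r₀ k * B′ (g r₀ k) j)
    row-r₀ j = trans (upper r₀ j (NP.≤-reflexive (cong suc r₀≡K)))
      (cong₂ _+_ (sym (spliceRows-≥ K X A r₀ j (NP.≤-reflexive (sym r₀≡K))))
        (sumFin-cong N (λ k → cong (c r₀ k *_) (sym (spliceRows-≥ K X A (g r₀ k) j
          (NP.<⇒≤ (subst (_< toℕ (g r₀ k)) r₀≡K (r₀<g k))))))))

punchIn-↑ʳ : (a b : ℕ) (j : Fin (suc a)) (k : Fin b) → punchIn (j ↑ˡ b) (a ↑ʳ k) ≡ suc a ↑ʳ k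
punchIn-↑ʳ zero b fzero k = refl
punchIn-↑ʳ (suc a) b fzero k = refl
punchIn-↑ʳ (suc a) b (fsuc j) k = cong fsuc (punchIn-↑ʳ a b j k)

punchIn-↑ˡ : (a b : ℕ) (j : Fin (suc a)) (k : Fin a) → punchIn (j ↑ˡ b) (k ↑ˡ b) ≡ punchIn j k ↑ˡ b
punchIn-↑ˡ a b fzero k = refl
punchIn-↑ˡ (suc a) b (fsuc j) fzero = refl
punchIn-↑ˡ (suc a) b (fsuc j) (fsuc k) = cong fsuc (punchIn-↑ˡ a b j k)

det-blockLowerTriangular : (a b : ℕ) (A : Matrix (a ℕ.+ b)) → (∀ i j → A (i ↑ˡ b) (a ↑ʳ j) ≡ 0ℚ) →
  det (a ℕ.+ b) A ≡ det a (λ i j → A (i ↑ˡ b) (j ↑ˡ b)) * det b (λ i j → A (a ↑ʳ i) (a ↑ʳ j))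
det-blockLowerTriangular zero b A upper-right-zero = sym (ℚP.*-identityˡ _)
det-blockLowerTriangular (suc a) b A upper-right-zero = begin
    det (suc a ℕ.+ b) A
  ≡⟨ sumFin-↑ (suc a) b (rowTerm A) ⟩
    sumFin (suc a) (λ j → rowTerm A (j ↑ˡ b)) + sumFin b (λ j → rowTerm A (suc a ↑ʳ j))
  ≡⟨ cong₂ _+_ (sumFin-cong (suc a) leftTerm) (sumFin-zero b _ rightTerm) ⟩
    sumFin (suc a) (λ j → rowTerm TL j * det b BR) + 0ℚ
  ≡⟨ ℚP.+-identityʳ _ ⟩
    sumFin (suc a) (λ j → rowTerm TL j * det b BR)
  ≡⟨ sumFin-cong (suc a) (λ j → ℚP.*-comm (rowTerm TL j) (det b BR)) ⟩
    sumFin (suc a) (λ j → det b BR * rowTerm TL j)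
  ≡⟨ sumFin-*ˡ (suc a) (det b BR) (rowTerm TL) ⟩
    det b BR * det (suc a) TL
  ≡⟨ ℚP.*-comm (det b BR) (det (suc a) TL) ⟩
    det (suc a) TL * det b BR ∎
  where
  TL : Matrix (suc a)
  TL i j = A (i ↑ˡ b) (j ↑ˡ b)
  BR : Matrix b
  BR i j = A (suc a ↑ʳ i) (suc a ↑ʳ j)
  rightTerm : ∀ j → rowTerm A (suc a ↑ʳ j) ≡ 0ℚ
  rightTerm j = trans (cong (λ u → (sign (toℕ (suc a ↑ʳ j)) * u) * det (a ℕ.+ b) (minor fzero (suc a ↑ʳ j) A)) (upper-right-zero fzero j))
    (solve 2 (λ s d → (s :* con 0ℚ) :* d := con 0ℚ) refl (sign (toℕ (suc a ↑ʳ j))) (det (a ℕ.+ b) (minor fzero (suc a ↑ʳ j) A)))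
  leftTerm : ∀ j → rowTerm A (j ↑ˡ b) ≡ rowTerm TL j * det b BR
  leftTerm j = begin
      (sign (toℕ (j ↑ˡ b)) * A fzero (j ↑ˡ b)) * det (a ℕ.+ b) (minor fzero (j ↑ˡ b) A)
    ≡⟨ cong₂ (λ u v → (sign u * A fzero (j ↑ˡ b)) * v) (FP.toℕ-↑ˡ j b)
        (det-blockLowerTriangular a b (minor fzero (j ↑ˡ b) A)
          (λ i k → trans (cong (A (fsuc (i ↑ˡ b))) (punchIn-↑ʳ a b j k)) (upper-right-zero (fsuc i) k))) ⟩
      (sign (toℕ j) * TL fzero j) * (det a (λ i k → A (fsuc (i ↑ˡ b)) (punchIn (j ↑ˡ b) (k ↑ˡ b)))
                                      * det b (λ i k → A (fsuc (a ↑ʳ i)) (punchIn (j ↑ˡ b) (a ↑ʳ k))))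
    ≡⟨ cong₂ (λ u v → (sign (toℕ j) * TL fzero j) * (u * v))
        (det-cong a (λ i k → cong (A (fsuc (i ↑ˡ b))) (punchIn-↑ˡ a b j k)))
        (det-cong b (λ i k → cong (A (fsuc (a ↑ʳ i))) (punchIn-↑ʳ a b j k))) ⟩
      (sign (toℕ j) * TL fzero j) * (det a (minor fzero j TL) * det b BR)
    ≡⟨ sym (ℚP.*-assoc (sign (toℕ j) * TL fzero j) (det a (minor fzero j TL)) (det b BR)) ⟩
      rowTerm TL j * det b BR ∎

det-identity : (b : ℕ) (A : Matrix b) → (∀ i j → A i j ≡ δ (toℕ i) (toℕ j)) → det b A ≡ 1ℚ
det-identity zero A A≡I = refl
det-identity (suc b) A A≡I = begin
    det (suc b) A
  ≡⟨ sumFin-single (suc b) (rowTerm A) fzero offDiagonal ⟩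
    (1ℚ * A fzero fzero) * det b (minor fzero fzero A)
  ≡⟨ cong₂ (λ u v → (1ℚ * u) * v) (A≡I fzero fzero) (det-identity b (minor fzero fzero A) (λ i j → A≡I (fsuc i) (fsuc j))) ⟩
    (1ℚ * 1ℚ) * 1ℚ
  ≡⟨⟩
    1ℚ ∎
  where
  offDiagonal : ∀ j → j ≢ fzero → rowTerm A j ≡ 0ℚ
  offDiagonal fzero j≢0 = ⊥-elim (j≢0 refl)
  offDiagonal (fsuc j) _ = trans (cong (λ u → (sign (toℕ (fsuc j)) * u) * det b (minor fzero (fsuc j) A)) (A≡I fzero (fsuc j)))
    (solve 2 (λ s d → (s :* con 0ℚ) :* d := con 0ℚ) refl (sign (toℕ (fsuc j))) (det b (minor fzero (fsuc j) A)))

-- Rows r < k are x·e_{r+1}; expanding k times along the first row leaves the 2×2 minor on the last two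
-- rows and the first and last columns.
det-shiftedRows : (x k : ℕ) (A : Matrix (suc (suc k))) →
  (∀ r q → toℕ r < k → A r q ≡ ℕtoℚ x * δ (toℕ q) (suc (toℕ r))) →
  let r₁ = inject₁ (fromℕ k); r₂ = fromℕ (suc k) in
  det (suc (suc k)) A ≡ (sign k * ℕtoℚ (x ^ k)) * (A r₁ fzero * A r₂ r₂ + - (A r₁ r₂ * A r₂ fzero))
det-shiftedRows x zero A _ = solve 4 (λ a b c d →
    (con 1ℚ :* a) :* ((con 1ℚ :* d) :* con 1ℚ :+ con 0ℚ) :+ ((:- con 1ℚ :* b) :* ((con 1ℚ :* c) :* con 1ℚ :+ con 0ℚ) :+ con 0ℚ)
    := (con 1ℚ :* con 1ℚ) :* (a :* d :+ :- (b :* c))) refl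
  (A fzero fzero) (A fzero (fsuc fzero)) (A (fsuc fzero) fzero) (A (fsuc fzero) (fsuc fzero))
det-shiftedRows x (suc k) A rows = begin
    rowTerm A fzero + (rowTerm A (fsuc fzero) + sumFin (suc k) (rowTerm A ∘ fsuc ∘ fsuc))
  ≡⟨ cong₂ (λ u v → u + (rowTerm A (fsuc fzero) + v)) (vanishes fzero (λ ())) (sumFin-zero (suc k) _ (λ j → vanishes (fsuc (fsuc j)) (λ ()))) ⟩
    0ℚ + (rowTerm A (fsuc fzero) + 0ℚ)
  ≡⟨ cong₂ (λ u v → 0ℚ + ((- 1ℚ * u) * v + 0ℚ)) (rows fzero (fsuc fzero) (s≤s z≤n))
       (det-shiftedRows x k (minor fzero (fsuc fzero) A) (λ r q r<k → trans (rows (fsuc r) (punchIn (fsuc fzero) q) (s≤s r<k)) (shift r q))) ⟩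
    0ℚ + ((- 1ℚ * (ℕtoℚ x * 1ℚ)) * ((sign k * ℕtoℚ (x ^ k)) * D) + 0ℚ)
  ≡⟨ solve 4 (λ t s p d → con 0ℚ :+ ((:- con 1ℚ :* (t :* con 1ℚ)) :* ((s :* p) :* d) :+ con 0ℚ) := (:- s :* (t :* p)) :* d) refl
       (ℕtoℚ x) (sign k) (ℕtoℚ (x ^ k)) D ⟩
    (sign (suc k) * (ℕtoℚ x * ℕtoℚ (x ^ k))) * D
  ≡⟨ cong (λ u → (sign (suc k) * u) * D) (sym (ℕtoℚ-* x (x ^ k))) ⟩
    (sign (suc k) * ℕtoℚ (x ^ suc k)) * D ∎
  where
  r₁ = inject₁ (fromℕ (suc k))
  r₂ = fromℕ (suc (suc k))
  D = A r₁ fzero * A r₂ r₂ + - (A r₁ r₂ * A r₂ fzero)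
  vanishes : ∀ j → j ≢ fsuc fzero → rowTerm A j ≡ 0ℚ
  vanishes j j≢1 = trans (cong (λ u → (sign (toℕ j) * u) * det (suc (suc k)) (minor fzero j A)) (rows fzero j (s≤s z≤n)))
    (trans (cong (λ u → (sign (toℕ j) * (ℕtoℚ x * u)) * det (suc (suc k)) (minor fzero j A)) (δ-≢ (j≢1 ∘ FP.toℕ-injective)))
      (solve 3 (λ s t d → (s :* (t :* con 0ℚ)) :* d := con 0ℚ) refl (sign (toℕ j)) (ℕtoℚ x) (det (suc (suc k)) (minor fzero j A))))
  shift : ∀ (r : Fin (suc (suc k))) q →
    ℕtoℚ x * δ (toℕ (punchIn (fsuc fzero) q)) (suc (toℕ (fsuc r))) ≡ ℕtoℚ x * δ (toℕ q) (suc (toℕ r))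
  shift r fzero = refl
  shift r (fsuc q) = refl

-- The circulant coefficients

-- The theorem concerns n = order p = 2(p + 2); the circulant blocks have size μ p = n − 1 = 2p + 3.
order μ : ℕ → ℕ
order p = suc (suc p) ℕ.* 2
μ p = suc (suc (suc (p ℕ.* 2)))

-- (−1)^d (M − 2d)/2: for 1 ≤ d ≤ n/2 − 1 and M = n − 1 this is the paper's coefficient of C_d.
circCoeff : ℕ → ℕ → ℚ
circCoeff M d = sign d * (½ * (ℕtoℚ M + - (ℕtoℚ d + ℕtoℚ d)))

coeff≡circCoeff : (p d : ℕ) → coeff (order p) d ≡ circCoeff (μ p) d
coeff≡circCoeff p d = cong (sign d *_) (begin
    (ℤ.+ μ p ℤ.- ℤ.+ (2 ℕ.* d)) Data.Rational./ 2
  ≡⟨ z/2≡½*z (ℤ.+ μ p ℤ.+ ℤ.- ℤ.+ (2 ℕ.* d)) ⟩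
    ½ * ℤtoℚ (ℤ.+ μ p ℤ.+ ℤ.- ℤ.+ (2 ℕ.* d))
  ≡⟨ cong (½ *_) (trans (ℤtoℚ-+ (ℤ.+ μ p) (ℤ.- ℤ.+ (2 ℕ.* d))) (cong (ℕtoℚ (μ p) +_) (ℤtoℚ-neg (ℤ.+ (2 ℕ.* d))))) ⟩
    ½ * (ℕtoℚ (μ p) + - ℕtoℚ (d ℕ.+ (d ℕ.+ 0)))
  ≡⟨ cong (λ u → ½ * (ℕtoℚ (μ p) + - u)) (trans (ℕtoℚ-+ d (d ℕ.+ 0)) (cong (ℕtoℚ d +_) (cong ℕtoℚ (NP.+-identityʳ d)))) ⟩
    ½ * (ℕtoℚ (μ p) + - (ℕtoℚ d + ℕtoℚ d)) ∎)

sign-+ : (a b : ℕ) → sign (a ℕ.+ b) ≡ sign a * sign b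
sign-+ zero b = sym (ℚP.*-identityˡ _)
sign-+ (suc a) b = trans (cong -_ (sign-+ a b)) (ℚP.neg-distribˡ-* (sign a) (sign b))

sign-*2 : (a : ℕ) → sign (a ℕ.* 2) ≡ 1ℚ
sign-*2 zero = refl
sign-*2 (suc a) = trans (solve 1 (λ s → :- (:- s) := s) refl (sign (a ℕ.* 2))) (sign-*2 a)

sign-μ : (p : ℕ) → sign (μ p) ≡ - 1ℚ
sign-μ p = cong (λ s → - (- (- s))) (sign-*2 p)

sign-*-sign : (d : ℕ) → sign d * sign d ≡ 1ℚ
sign-*-sign d = trans (sym (sign-+ d d)) (trans (cong sign (trans (cong (d ℕ.+_) (sym (NP.+-identityʳ d))) (NP.*-comm 2 d))) (sign-*2 d))

circCoeff-zero : (M : ℕ) → circCoeff M 0 ≡ ½ * ℕtoℚ M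
circCoeff-zero M = solve 1 (λ M → con 1ℚ :* (con ½ :* (M :+ :- (con 0ℚ :+ con 0ℚ))) := con ½ :* M) refl (ℕtoℚ M)

circCoeff-reflect : (M e d : ℕ) → sign M ≡ - 1ℚ → e ℕ.+ d ≡ M → circCoeff M e ≡ circCoeff M d
circCoeff-reflect M e d M-odd e+d≡M = begin
    sign e * (½ * (ℕtoℚ M + - (ℕtoℚ e + ℕtoℚ e)))
  ≡⟨ cong₂ (λ s M → s * (½ * (M + - (ℕtoℚ e + ℕtoℚ e)))) sign-e (trans (cong ℕtoℚ (sym e+d≡M)) (ℕtoℚ-+ e d)) ⟩
    - sign d * (½ * ((ℕtoℚ e + ℕtoℚ d) + - (ℕtoℚ e + ℕtoℚ e)))
  ≡⟨ solve 3 (λ s E D → :- s :* (con ½ :* ((E :+ D) :+ :- (E :+ E))) := s :* (con ½ :* ((E :+ D) :+ :- (D :+ D)))) refl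
       (sign d) (ℕtoℚ e) (ℕtoℚ d) ⟩
    sign d * (½ * ((ℕtoℚ e + ℕtoℚ d) + - (ℕtoℚ d + ℕtoℚ d)))
  ≡⟨ cong (λ M → sign d * (½ * (M + - (ℕtoℚ d + ℕtoℚ d)))) (trans (sym (ℕtoℚ-+ e d)) (cong ℕtoℚ e+d≡M)) ⟩
    circCoeff M d ∎
  where
  sign-e : sign e ≡ - sign d
  sign-e = begin
    sign e                     ≡⟨ sym (ℚP.*-identityʳ (sign e)) ⟩
    sign e * 1ℚ                ≡⟨ cong (sign e *_) (sym (sign-*-sign d)) ⟩
    sign e * (sign d * sign d) ≡⟨ sym (ℚP.*-assoc (sign e) (sign d) (sign d)) ⟩
    (sign e * sign d) * sign d ≡⟨ cong (_* sign d) (trans (sym (sign-+ e d)) (trans (cong sign e+d≡M) M-odd)) ⟩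
    - 1ℚ * sign d              ≡⟨ solve 1 (λ s → :- con 1ℚ :* s := :- s) refl (sign d) ⟩
    - sign d                   ∎

circCoeff-recurrence : (M d : ℕ) → circCoeff M d + (ℕtoℚ 2 * circCoeff M (suc d) + (1ℚ * circCoeff M (suc (suc d)) + 0ℚ)) ≡ 0ℚ
circCoeff-recurrence M d = begin
    circCoeff M d + (ℕtoℚ 2 * circCoeff M (suc d) + (1ℚ * circCoeff M (suc (suc d)) + 0ℚ))
  ≡⟨ cong₂ (λ u v → circCoeff M d + (ℕtoℚ 2 * (- sign d * (½ * (ℕtoℚ M + - (u + u))))
                                      + (1ℚ * (- - sign d * (½ * (ℕtoℚ M + - (v + v)))) + 0ℚ)))
       (ℕtoℚ-suc d) (trans (ℕtoℚ-suc (suc d)) (cong (1ℚ +_) (ℕtoℚ-suc d))) ⟩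
    _
  ≡⟨ solve 3 (λ s M D → s :* (con ½ :* (M :+ :- (D :+ D)))
        :+ ((con 1ℚ :+ con 1ℚ) :* (:- s :* (con ½ :* (M :+ :- ((con 1ℚ :+ D) :+ (con 1ℚ :+ D)))))
        :+ (con 1ℚ :* (:- :- s :* (con ½ :* (M :+ :- ((con 1ℚ :+ (con 1ℚ :+ D)) :+ (con 1ℚ :+ (con 1ℚ :+ D)))))) :+ con 0ℚ))
        := con 0ℚ) refl (sign d) (ℕtoℚ M) (ℕtoℚ d) ⟩
    0ℚ ∎

circCoeff-centre : (M : ℕ) → circCoeff M 1 + (ℕtoℚ 2 * circCoeff M 0 + (1ℚ * circCoeff M 1 + 0ℚ)) ≡ ℕtoℚ 2
circCoeff-centre M = solve 1 (λ M → (:- con 1ℚ :* (con ½ :* (M :+ :- (con 1ℚ :+ con 1ℚ))))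
  :+ ((con 1ℚ :+ con 1ℚ) :* (con 1ℚ :* (con ½ :* (M :+ :- (con 0ℚ :+ con 0ℚ))))
  :+ (con 1ℚ :* (:- con 1ℚ :* (con ½ :* (M :+ :- (con 1ℚ :+ con 1ℚ)))) :+ con 0ℚ))
  := con 1ℚ :+ con 1ℚ) refl (ℕtoℚ M)

circCoeff-corner : (p : ℕ) → let K = suc (p ℕ.* 2) in
  circCoeff (μ p) K * circCoeff (μ p) 0 + - (circCoeff (μ p) 1 * circCoeff (μ p) (suc K)) ≡ - 1ℚ
circCoeff-corner p = begin
    circCoeff (μ p) K * circCoeff (μ p) 0 + - (circCoeff (μ p) 1 * circCoeff (μ p) (suc K))
  ≡⟨ cong₂ (λ u v → u * circCoeff (μ p) 0 + - (circCoeff (μ p) 1 * v))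
       (circCoeff-reflect (μ p) K 2 (sign-μ p) (NP.+-comm K 2)) (circCoeff-reflect (μ p) (suc K) 1 (sign-μ p) (NP.+-comm (suc K) 1)) ⟩
    circCoeff (μ p) 2 * circCoeff (μ p) 0 + - (circCoeff (μ p) 1 * circCoeff (μ p) 1)
  ≡⟨ solve 1 (λ M → (con 1ℚ :* (con ½ :* (M :+ :- (con (ℕtoℚ 2) :+ con (ℕtoℚ 2))))) :* (con 1ℚ :* (con ½ :* (M :+ :- (con 0ℚ :+ con 0ℚ))))
        :+ :- ((:- con 1ℚ :* (con ½ :* (M :+ :- (con 1ℚ :+ con 1ℚ)))) :* (:- con 1ℚ :* (con ½ :* (M :+ :- (con 1ℚ :+ con 1ℚ)))))
        := :- con 1ℚ) refl (ℕtoℚ (μ p)) ⟩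
    - 1ℚ ∎
  where
  K = suc (p ℕ.* 2)

circCoeff-even : (M j : ℕ) → circCoeff M (j ℕ.* 2) ≡ ½ * (ℕtoℚ M + - ((ℕtoℚ j + ℕtoℚ j) + (ℕtoℚ j + ℕtoℚ j)))
circCoeff-even M j = trans (cong₂ (λ s u → s * (½ * (ℕtoℚ M + - (u + u)))) (sign-*2 j) (ℕtoℚ-*2 j)) (ℚP.*-identityˡ _)

circCoeff-odd : (M j : ℕ) →
  circCoeff M (suc (j ℕ.* 2)) ≡ - (½ * (ℕtoℚ M + - ((1ℚ + (ℕtoℚ j + ℕtoℚ j)) + (1ℚ + (ℕtoℚ j + ℕtoℚ j)))))
circCoeff-odd M j = trans
  (cong₂ (λ s u → - s * (½ * (ℕtoℚ M + - (u + u)))) (sign-*2 j) (trans (ℕtoℚ-suc (j ℕ.* 2)) (cong (1ℚ +_) (ℕtoℚ-*2 j))))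
  (trans (sym (ℚP.neg-distribˡ-* 1ℚ y)) (cong -_ (ℚP.*-identityˡ y)))
  where
  y = ½ * (ℕtoℚ M + - ((1ℚ + (ℕtoℚ j + ℕtoℚ j)) + (1ℚ + (ℕtoℚ j + ℕtoℚ j))))

sumℕ-circCoeff-even : (M j : ℕ) → sumℕ (j ℕ.* 2) (circCoeff M) ≡ ℕtoℚ j
sumℕ-circCoeff-even M zero = refl
sumℕ-circCoeff-even M (suc j) = begin
    sumℕ (suc (suc (j ℕ.* 2))) (circCoeff M)
  ≡⟨ trans (sumℕ-snoc (suc (j ℕ.* 2)) (circCoeff M)) (cong (_+ circCoeff M (suc (j ℕ.* 2))) (sumℕ-snoc (j ℕ.* 2) (circCoeff M))) ⟩
    (sumℕ (j ℕ.* 2) (circCoeff M) + circCoeff M (j ℕ.* 2)) + circCoeff M (suc (j ℕ.* 2))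
  ≡⟨ cong₂ (λ u v → u + v) (cong₂ _+_ (sumℕ-circCoeff-even M j) (circCoeff-even M j)) (circCoeff-odd M j) ⟩
    (J + ½ * (ℕtoℚ M + - ((J + J) + (J + J)))) + - (½ * (ℕtoℚ M + - ((1ℚ + (J + J)) + (1ℚ + (J + J)))))
  ≡⟨ solve 2 (λ M J → (J :+ con ½ :* (M :+ :- ((J :+ J) :+ (J :+ J))))
                      :+ :- (con ½ :* (M :+ :- ((con 1ℚ :+ (J :+ J)) :+ (con 1ℚ :+ (J :+ J))))) := con 1ℚ :+ J) refl (ℕtoℚ M) J ⟩
    1ℚ + J
  ≡⟨ sym (ℕtoℚ-suc j) ⟩
    ℕtoℚ (suc j) ∎
  where
  J = ℕtoℚ j

sumℕ-circCoeff-odd : (M j : ℕ) → sumℕ (suc (j ℕ.* 2)) (circCoeff M) ≡ ½ * (ℕtoℚ M + - (ℕtoℚ j + ℕtoℚ j))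
sumℕ-circCoeff-odd M j = begin
    sumℕ (suc (j ℕ.* 2)) (circCoeff M)
  ≡⟨ sumℕ-snoc (j ℕ.* 2) (circCoeff M) ⟩
    sumℕ (j ℕ.* 2) (circCoeff M) + circCoeff M (j ℕ.* 2)
  ≡⟨ cong₂ _+_ (sumℕ-circCoeff-even M j) (circCoeff-even M j) ⟩
    ℕtoℚ j + ½ * (ℕtoℚ M + - ((ℕtoℚ j + ℕtoℚ j) + (ℕtoℚ j + ℕtoℚ j)))
  ≡⟨ solve 2 (λ M J → J :+ con ½ :* (M :+ :- ((J :+ J) :+ (J :+ J))) := con ½ :* (M :+ :- (J :+ J))) refl (ℕtoℚ M) (ℕtoℚ j) ⟩
    ½ * (ℕtoℚ M + - (ℕtoℚ j + ℕtoℚ j)) ∎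

even-or-odd : (a : ℕ) → Σ ℕ (λ j → a ≡ j ℕ.* 2) ⊎ Σ ℕ (λ j → a ≡ suc (j ℕ.* 2))
even-or-odd zero = inj₁ (0 , refl)
even-or-odd (suc a) with even-or-odd a
... | inj₁ (j , a≡2j) = inj₂ (j , cong suc a≡2j)
... | inj₂ (j , a≡2j+1) = inj₁ (suc j , cong suc a≡2j+1)

even≢odd : (x y : ℕ) → x ℕ.* 2 ≢ suc (y ℕ.* 2)
even≢odd zero y ()
even≢odd (suc x) zero e = NP.0≢1+n (sym (NP.suc-injective e))
even≢odd (suc x) (suc y) e = even≢odd x y (NP.suc-injective (NP.suc-injective e))

-- The two summation ranges have lengths of equal parity because a + 1 + r = μ p is odd.
sumℕ-circCoeff-twoSided : (p a r : ℕ) → suc a ℕ.+ r ≡ μ p →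
  sumℕ (suc a) (circCoeff (μ p)) + (sumℕ (suc r) (circCoeff (μ p)) + - (½ * ℕtoℚ (μ p))) ≡ ½
sumℕ-circCoeff-twoSided p a r a+1+r≡μ with even-or-odd a | even-or-odd r
... | inj₁ (j , refl) | inj₁ (e , refl) = begin
    sumℕ (suc (j ℕ.* 2)) (circCoeff (μ p)) + (sumℕ (suc (e ℕ.* 2)) (circCoeff (μ p)) + - (½ * ℕtoℚ (μ p)))
  ≡⟨ cong₂ (λ u v → u + (v + - (½ * ℕtoℚ (μ p)))) (sumℕ-circCoeff-odd (μ p) j) (sumℕ-circCoeff-odd (μ p) e) ⟩
    ½ * (ℕtoℚ (μ p) + - (J + J)) + (½ * (ℕtoℚ (μ p) + - (E + E)) + - (½ * ℕtoℚ (μ p)))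
  ≡⟨ cong (λ M → ½ * (M + - (J + J)) + (½ * (M + - (E + E)) + - (½ * M))) μ≡ ⟩
    ½ * (X + - (J + J)) + (½ * (X + - (E + E)) + - (½ * X))
  ≡⟨ solve 2 (λ J E → con ½ :* ((con 1ℚ :+ ((J :+ J) :+ (E :+ E))) :+ :- (J :+ J))
                      :+ (con ½ :* ((con 1ℚ :+ ((J :+ J) :+ (E :+ E))) :+ :- (E :+ E)) :+ :- (con ½ :* (con 1ℚ :+ ((J :+ J) :+ (E :+ E)))))
                      := con ½) refl J E ⟩
    ½ ∎
  where
  J = ℕtoℚ j
  E = ℕtoℚ e
  X = 1ℚ + ((J + J) + (E + E))
  μ≡ : ℕtoℚ (μ p) ≡ X
  μ≡ = begin
    ℕtoℚ (μ p)                             ≡⟨ cong ℕtoℚ (sym a+1+r≡μ) ⟩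
    ℕtoℚ (suc (j ℕ.* 2 ℕ.+ e ℕ.* 2))       ≡⟨ ℕtoℚ-suc (j ℕ.* 2 ℕ.+ e ℕ.* 2) ⟩
    1ℚ + ℕtoℚ (j ℕ.* 2 ℕ.+ e ℕ.* 2)        ≡⟨ cong (1ℚ +_) (ℕtoℚ-*2+*2 j e) ⟩
    X                                      ∎
... | inj₂ (j , refl) | inj₂ (e , refl) = begin
    sumℕ (suc j ℕ.* 2) (circCoeff (μ p)) + (sumℕ (suc e ℕ.* 2) (circCoeff (μ p)) + - (½ * ℕtoℚ (μ p)))
  ≡⟨ cong₂ (λ u v → u + (v + - (½ * ℕtoℚ (μ p))))
       (trans (sumℕ-circCoeff-even (μ p) (suc j)) (ℕtoℚ-suc j)) (trans (sumℕ-circCoeff-even (μ p) (suc e)) (ℕtoℚ-suc e)) ⟩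
    (1ℚ + J) + ((1ℚ + E) + - (½ * ℕtoℚ (μ p)))
  ≡⟨ cong (λ M → (1ℚ + J) + ((1ℚ + E) + - (½ * M))) μ≡ ⟩
    (1ℚ + J) + ((1ℚ + E) + - (½ * (1ℚ + (1ℚ + (1ℚ + ((J + J) + (E + E)))))))
  ≡⟨ solve 2 (λ J E → (con 1ℚ :+ J) :+ ((con 1ℚ :+ E) :+ :- (con ½ :* (con 1ℚ :+ (con 1ℚ :+ (con 1ℚ :+ ((J :+ J) :+ (E :+ E)))))))
                      := con ½) refl J E ⟩
    ½ ∎
  where
  J = ℕtoℚ j
  E = ℕtoℚ e
  s = j ℕ.* 2 ℕ.+ e ℕ.* 2
  μ≡ : ℕtoℚ (μ p) ≡ 1ℚ + (1ℚ + (1ℚ + ((J + J) + (E + E))))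
  μ≡ = begin
    ℕtoℚ (μ p)                                   ≡⟨ cong ℕtoℚ (trans (sym a+1+r≡μ) (cong (suc ∘ suc) (NP.+-suc (j ℕ.* 2) (e ℕ.* 2)))) ⟩
    ℕtoℚ (suc (suc (suc (j ℕ.* 2 ℕ.+ e ℕ.* 2)))) ≡⟨ trans (ℕtoℚ-suc (suc (suc s))) (cong (1ℚ +_) (trans (ℕtoℚ-suc (suc s)) (cong (1ℚ +_) (ℕtoℚ-suc s)))) ⟩
    1ℚ + (1ℚ + (1ℚ + ℕtoℚ (j ℕ.* 2 ℕ.+ e ℕ.* 2))) ≡⟨ cong (λ x → 1ℚ + (1ℚ + (1ℚ + x))) (ℕtoℚ-*2+*2 j e) ⟩
    1ℚ + (1ℚ + (1ℚ + ((J + J) + (E + E))))        ∎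
... | inj₁ (j , refl) | inj₂ (e , refl) = ⊥-elim (even≢odd (j ℕ.+ e) p (trans (NP.*-distribʳ-+ 2 j e)
    (NP.suc-injective (trans (sym (NP.+-suc (j ℕ.* 2) (e ℕ.* 2))) (NP.suc-injective a+1+r≡μ)))))
... | inj₂ (j , refl) | inj₁ (e , refl) = ⊥-elim (even≢odd (j ℕ.+ e) p (trans (NP.*-distribʳ-+ 2 j e)
    (NP.suc-injective (NP.suc-injective a+1+r≡μ))))

-- Split the row at the diagonal: left of it the distances run a, …, 0, right of it 1, …, r.
circCoeff-rowSum : (p a : ℕ) → a < μ p → sumℕ (μ p) (λ b → circCoeff (μ p) ∣ a - b ∣) ≡ ½
circCoeff-rowSum p a a<μ = begin
    sumℕ M f
  ≡⟨ cong (λ k → sumℕ k f) (sym a+1+r≡M) ⟩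
    sumℕ (suc a ℕ.+ r) f
  ≡⟨ sumℕ-split (suc a) r f ⟩
    sumℕ (suc a) f + sumℕ r (λ x → f (suc a ℕ.+ x))
  ≡⟨ cong₂ _+_ (trans (sumℕ-cong (suc a) (λ b b≤a → cong (circCoeff M) (NP.m≤n⇒∣n-m∣≡n∸m (ℕ.s≤s⁻¹ b≤a)))) (sumℕ-reverse a (circCoeff M)))
               (sumℕ-cong r (λ x _ → cong (circCoeff M) (distance x))) ⟩
    sumℕ (suc a) (circCoeff M) + sumℕ r (circCoeff M ∘ suc)
  ≡⟨ solve 3 (λ A R c → A :+ R := A :+ ((c :+ R) :+ :- c)) refl (sumℕ (suc a) (circCoeff M)) (sumℕ r (circCoeff M ∘ suc)) (circCoeff M 0) ⟩
    sumℕ (suc a) (circCoeff M) + (sumℕ (suc r) (circCoeff M) + - circCoeff M 0)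
  ≡⟨ cong (λ u → sumℕ (suc a) (circCoeff M) + (sumℕ (suc r) (circCoeff M) + - u)) (circCoeff-zero M) ⟩
    sumℕ (suc a) (circCoeff M) + (sumℕ (suc r) (circCoeff M) + - (½ * ℕtoℚ M))
  ≡⟨ sumℕ-circCoeff-twoSided p a r a+1+r≡M ⟩
    ½ ∎
  where
  M = μ p
  f : ℕ → ℚ
  f b = circCoeff M ∣ a - b ∣
  r = M ∸ suc a
  a+1+r≡M : suc a ℕ.+ r ≡ M
  a+1+r≡M = NP.m+[n∸m]≡n a<μ
  distance : ∀ x → ∣ a - suc a ℕ.+ x ∣ ≡ suc x
  distance x = trans (NP.m≤n⇒∣m-n∣≡n∸m (NP.≤-trans (NP.n≤1+n a) (NP.m≤m+n (suc a) x)))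
                     (trans (cong (_∸ a) (sym (NP.+-suc a x))) (NP.m+n∸m≡n a (suc x)))

-- The circulant sum

-- Entry (a, b) of every C_k reads the vector c^k at the cyclic offset of b from a.
offset : ℕ → ℕ → ℕ → ℕ
offset p a b = if a ≤ᵇ b then b ∸ a else (b ℕ.+ μ p) ∸ a

circTerm : ℕ → ℕ → ℕ → ℚ
circTerm p t k = coeff (order p) (suc k) * cvec (order p) (suc k) (suc t)

circSum≡sumℕ-circTerm : (p a b : ℕ) → circSum (order p) a b ≡ sumℕ (suc p) (circTerm p (offset p a b))
circSum≡sumℕ-circTerm p a b = trans (sumFin-toℕ (order p ℕ./ 2 ∸ 1) (circTerm p (offset p a b)))
  (cong (λ m → sumℕ (m ∸ 1) (circTerm p (offset p a b))) (DM.m*n/n≡m (suc (suc p)) 2))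

≤ᵇ-≤ : {a b : ℕ} → a ≤ b → (a ≤ᵇ b) ≡ true
≤ᵇ-≤ a≤b = T⇒≡true (NP.≤⇒≤ᵇ a≤b)

≤ᵇ-> : {a b : ℕ} → b < a → (a ≤ᵇ b) ≡ false
≤ᵇ-> {a} {b} b<a with a ≤ᵇ b in eq
... | true = ⊥-elim (NP.<⇒≱ b<a (NP.≤ᵇ⇒≤ a b (subst T (sym eq) _)))
... | false = refl

cvec-first : (p k t : ℕ) → t ≡ k → cvec (order p) k (suc t) ≡ 1ℚ
cvec-first p k t t≡k = cong (λ b → if b ∨ (suc t ≡ᵇ order p ∸ k) then 1ℚ else 0ℚ) (≡ᵇ-≡ t≡k)

cvec-second : (p k t : ℕ) → k ≤ μ p → t ℕ.+ k ≡ μ p → cvec (order p) k (suc t) ≡ 1ℚ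
cvec-second p k t k≤μ t+k≡μ =
  trans (cong (λ b → if (t ≡ᵇ k) ∨ b then 1ℚ else 0ℚ) (≡ᵇ-≡ (trans (cong suc t≡μ-k) (sym (NP.+-∸-assoc 1 k≤μ)))))
        (or-true (t ≡ᵇ k))
  where
  t≡μ-k : t ≡ μ p ∸ k
  t≡μ-k = trans (sym (NP.m+n∸n≡m t k)) (cong (_∸ k) t+k≡μ)
  or-true : (b : Bool) → (if b ∨ true then 1ℚ else 0ℚ) ≡ 1ℚ
  or-true true = refl
  or-true false = refl

cvec-other : (p k t : ℕ) → k ≤ μ p → t ≢ k → t ℕ.+ k ≢ μ p → cvec (order p) k (suc t) ≡ 0ℚ
cvec-other p k t k≤μ t≢k t+k≢μ = cong₂ (λ b c → if b ∨ c then 1ℚ else 0ℚ) (≡ᵇ-≢ t≢k)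
  (≡ᵇ-≢ (λ e → t+k≢μ (trans (cong (ℕ._+ k) (NP.suc-injective (trans e (NP.+-∸-assoc 1 k≤μ)))) (NP.m∸n+n≡m k≤μ))))

suc-p+suc-p : (p : ℕ) → suc p ℕ.+ suc p ≡ suc (suc (p ℕ.* 2))
suc-p+suc-p p = cong suc (trans (NP.+-suc p p) (cong suc (trans (cong (p ℕ.+_) (sym (NP.+-identityʳ p))) (NP.*-comm 2 p))))

small+small<μ : (p a b : ℕ) → a ≤ suc p → b ≤ suc p → a ℕ.+ b < μ p
small+small<μ p a b a≤p+1 b≤p+1 = s≤s (NP.≤-trans (NP.+-mono-≤ a≤p+1 b≤p+1) (NP.≤-reflexive (suc-p+suc-p p)))

k<p+1⇒k+1≤μ : (p k : ℕ) → k < suc p → suc k ≤ μ p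
k<p+1⇒k+1≤μ p k k<p+1 = NP.≤-trans k<p+1 (NP.≤-trans (NP.m≤m+n (suc p) (suc p))
  (NP.≤-trans (NP.≤-reflexive (suc-p+suc-p p)) (NP.n≤1+n _)))

-- For 0 < t < μ exactly one C_k has a 1 at offset t: k = t if t ≤ n/2 − 1, and k = μ − t otherwise.
sumℕ-circTerm : (p t : ℕ) → 1 ≤ t → t < μ p → sumℕ (suc p) (circTerm p t) ≡ circCoeff (μ p) t
sumℕ-circTerm p (suc t′) _ t<μ with suc t′ NP.≤? suc p
... | yes t≤p+1 = begin
    sumℕ (suc p) (circTerm p (suc t′))
  ≡⟨ sumℕ-single (suc p) (circTerm p (suc t′)) t′ t≤p+1 (λ k k<p+1 k≢t′ →
       trans (cong (coeff (order p) (suc k) *_)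
               (cvec-other p (suc k) (suc t′) (k<p+1⇒k+1≤μ p k k<p+1) (k≢t′ ∘ sym ∘ NP.suc-injective)
                 (λ e → NP.<-irrefl e (small+small<μ p (suc t′) (suc k) t≤p+1 k<p+1))))
             (ℚP.*-zeroʳ (coeff (order p) (suc k)))) ⟩
    coeff (order p) (suc t′) * cvec (order p) (suc t′) (suc (suc t′))
  ≡⟨ cong₂ _*_ (coeff≡circCoeff p (suc t′)) (cvec-first p (suc t′) (suc t′) refl) ⟩
    circCoeff (μ p) (suc t′) * 1ℚ
  ≡⟨ ℚP.*-identityʳ _ ⟩
    circCoeff (μ p) (suc t′) ∎
... | no t≰p+1 = begin
    sumℕ (suc p) (circTerm p t)
  ≡⟨ sumℕ-single (suc p) (circTerm p t) e e<p+1 others ⟩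
    coeff (order p) (suc e) * cvec (order p) (suc e) (suc t)
  ≡⟨ cong₂ _*_ (coeff≡circCoeff p (suc e)) (cvec-second p (suc e) t (NP.≤-trans (s≤s (NP.m≤n+m e t)) (NP.≤-reflexive t+1+e≡μ)) t+e+1≡μ) ⟩
    circCoeff (μ p) (suc e) * 1ℚ
  ≡⟨ ℚP.*-identityʳ _ ⟩
    circCoeff (μ p) (suc e)
  ≡⟨ circCoeff-reflect (μ p) (suc e) t (sign-μ p) (trans (NP.+-comm (suc e) t) t+e+1≡μ) ⟩
    circCoeff (μ p) t ∎
  where
  t = suc t′
  e = μ p ∸ suc t
  t+1+e≡μ : suc (t ℕ.+ e) ≡ μ p
  t+1+e≡μ = NP.m+[n∸m]≡n t<μ
  t+e+1≡μ : t ℕ.+ suc e ≡ μ p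
  t+e+1≡μ = trans (NP.+-suc t e) t+1+e≡μ
  e<p+1 : e < suc p
  e<p+1 = NP.≰⇒> (λ p+1≤e → NP.<-irrefl (sym t+1+e≡μ)
    (NP.≤-trans (s≤s (NP.≤-reflexive (sym (cong suc (suc-p+suc-p p))))) (s≤s (NP.+-mono-≤ (NP.≰⇒> t≰p+1) p+1≤e))))
  others : ∀ k → k < suc p → k ≢ e → circTerm p t k ≡ 0ℚ
  others k k<p+1 k≢e = trans (cong (coeff (order p) (suc k) *_)
      (cvec-other p (suc k) t (k<p+1⇒k+1≤μ p k k<p+1) (λ t≡k+1 → NP.<-irrefl (sym t≡k+1) (NP.<-≤-trans (s≤s k<p+1) (NP.≰⇒> t≰p+1)))
        (λ t+k+1≡μ → k≢e (NP.suc-injective (NP.+-cancelˡ-≡ t (suc k) (suc e) (trans t+k+1≡μ (sym t+e+1≡μ)))))))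
    (ℚP.*-zeroʳ (coeff (order p) (suc k)))

circSum-diagonal : (p a : ℕ) → circSum (order p) a a ≡ 0ℚ
circSum-diagonal p a = begin
    circSum (order p) a a
  ≡⟨ circSum≡sumℕ-circTerm p a a ⟩
    sumℕ (suc p) (circTerm p (offset p a a))
  ≡⟨ cong (λ t → sumℕ (suc p) (circTerm p t)) (trans (cong (λ b → if b then a ∸ a else (a ℕ.+ μ p) ∸ a) (≤ᵇ-≤ (NP.≤-refl {a}))) (NP.n∸n≡0 a)) ⟩
    sumℕ (suc p) (circTerm p 0)
  ≡⟨ sumℕ-zero (suc p) (circTerm p 0) (λ k k<p+1 → trans (cong (coeff (order p) (suc k) *_)
       (cvec-other p (suc k) 0 (k<p+1⇒k+1≤μ p k k<p+1) (λ ()) (λ e → NP.<-irrefl e (small+small<μ p 0 (suc k) z≤n k<p+1))))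
       (ℚP.*-zeroʳ (coeff (order p) (suc k)))) ⟩
    0ℚ ∎

circSum-offDiagonal : (p a b : ℕ) → a < μ p → b < μ p → a ≢ b → circSum (order p) a b ≡ circCoeff (μ p) ∣ a - b ∣
circSum-offDiagonal p a b a<μ b<μ a≢b with a NP.≤? b
... | yes a≤b = begin
    circSum (order p) a b
  ≡⟨ circSum≡sumℕ-circTerm p a b ⟩
    sumℕ (suc p) (circTerm p (offset p a b))
  ≡⟨ cong (λ t → sumℕ (suc p) (circTerm p t)) (cong (λ c → if c then b ∸ a else (b ℕ.+ μ p) ∸ a) (≤ᵇ-≤ a≤b)) ⟩
    sumℕ (suc p) (circTerm p (b ∸ a))
  ≡⟨ sumℕ-circTerm p (b ∸ a) (NP.m<n⇒0<n∸m (NP.≤∧≢⇒< a≤b a≢b)) (NP.≤-<-trans (NP.m∸n≤m b a) b<μ) ⟩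
    circCoeff (μ p) (b ∸ a)
  ≡⟨ cong (circCoeff (μ p)) (sym (NP.m≤n⇒∣m-n∣≡n∸m a≤b)) ⟩
    circCoeff (μ p) ∣ a - b ∣ ∎
... | no a≰b = begin
    circSum (order p) a b
  ≡⟨ circSum≡sumℕ-circTerm p a b ⟩
    sumℕ (suc p) (circTerm p (offset p a b))
  ≡⟨ cong (λ t → sumℕ (suc p) (circTerm p t)) (cong (λ c → if c then b ∸ a else (b ℕ.+ μ p) ∸ a) (≤ᵇ-> b<a)) ⟩
    sumℕ (suc p) (circTerm p t)
  ≡⟨ sumℕ-circTerm p t (NP.m<n⇒0<n∸m (NP.<-≤-trans a<μ (NP.m≤n+m (μ p) b))) (NP.<-≤-trans (NP.m<m+n t (NP.m<n⇒0<n∸m b<a)) (NP.≤-reflexive t+[a-b]≡μ)) ⟩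
    circCoeff (μ p) t
  ≡⟨ circCoeff-reflect (μ p) t (a ∸ b) (sign-μ p) t+[a-b]≡μ ⟩
    circCoeff (μ p) (a ∸ b)
  ≡⟨ cong (circCoeff (μ p)) (sym (NP.m≤n⇒∣n-m∣≡n∸m (NP.<⇒≤ b<a))) ⟩
    circCoeff (μ p) ∣ a - b ∣ ∎
  where
  b<a : b < a
  b<a = NP.≰⇒> a≰b
  t = (b ℕ.+ μ p) ∸ a
  t+[a-b]≡μ : t ℕ.+ (a ∸ b) ≡ μ p
  t+[a-b]≡μ = begin
      (b ℕ.+ μ p) ∸ a ℕ.+ (a ∸ b)                 ≡⟨ cong (λ x → (b ℕ.+ μ p) ∸ x ℕ.+ (a ∸ b)) (sym (NP.m+[n∸m]≡n (NP.<⇒≤ b<a))) ⟩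
      (b ℕ.+ μ p) ∸ (b ℕ.+ (a ∸ b)) ℕ.+ (a ∸ b)   ≡⟨ cong (ℕ._+ (a ∸ b)) (NP.[m+n]∸[m+o]≡n∸o b (μ p) (a ∸ b)) ⟩
      μ p ∸ (a ∸ b) ℕ.+ (a ∸ b)                   ≡⟨ NP.m∸n+n≡m (NP.≤-trans (NP.m∸n≤m a b) (NP.<⇒≤ a<μ)) ⟩
      μ p                                         ∎

-- So Σ_k coeff_k C_k is the symmetric Toeplitz matrix (circCoeff ∣a − b∣) with its diagonal removed.
circSum≡ : (p a b : ℕ) → a < μ p → b < μ p →
  circSum (order p) a b ≡ circCoeff (μ p) ∣ a - b ∣ + - circCoeff (μ p) 0 * δ a b
circSum≡ p a b a<μ b<μ with a NP.≟ b
... | yes refl = trans (circSum-diagonal p a) (sym (trans (cong₂ (λ u v → circCoeff (μ p) u + - circCoeff (μ p) 0 * v) (NP.∣n-n∣≡0 a) (δ-≡ a))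
        (solve 1 (λ c → c :+ :- c :* con 1ℚ := con 0ℚ) refl (circCoeff (μ p) 0))))
... | no a≢b = trans (circSum-offDiagonal p a b a<μ b<μ a≢b) (sym (trans (cong (λ v → circCoeff (μ p) ∣ a - b ∣ + - circCoeff (μ p) 0 * v) (δ-≢ a≢b))
        (solve 2 (λ x c → x :+ :- c :* con 0ℚ := x) refl (circCoeff (μ p) ∣ a - b ∣) (circCoeff (μ p) 0))))

blockEntry : ℕ → ℕ → ℕ → ℕ → ℕ → ℚ
blockEntry n x y u v = ½ * baseBlock n x y u v + (if (x ≡ᵇ 1) ∧ (y ≡ᵇ 1) then circSum n u v else 0ℚ)

Lentry-blockEntry : (p i j : ℕ) {x y u v : ℕ} → blk (order p) i ≡ x → blk (order p) j ≡ y →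
  loc (order p) i ≡ u → loc (order p) j ≡ v → Lentry (order p) i j ≡ blockEntry (order p) x y u v
Lentry-blockEntry p i j refl refl refl refl = refl

-- Indices of the helm graph: the hub 0, the rim 1 + a and the pendant vertex 1 + μ + a of rim vertex a.
data Vertex (p : ℕ) : ℕ → Set where
  hub : Vertex p 0
  rim : (a : ℕ) → a < μ p → Vertex p (suc a)
  pendant : (a : ℕ) → a < μ p → Vertex p (suc (μ p ℕ.+ a))

vertex : (p i : ℕ) → i < suc (μ p ℕ.+ μ p) → Vertex p i
vertex p zero _ = hub
vertex p (suc a) (s≤s a<2μ) with a NP.<? μ p
... | yes a<μ = rim a a<μ
... | no a≮μ = subst (λ x → Vertex p (suc x)) (NP.m+[n∸m]≡n (NP.≮⇒≥ a≮μ))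
    (pendant (a ∸ μ p) (subst (a ∸ μ p <_) (NP.m+n∸m≡n (μ p) (μ p)) (NP.∸-monoˡ-< a<2μ (NP.≮⇒≥ a≮μ))))

blk-rim : (p a : ℕ) → a < μ p → blk (order p) (suc a) ≡ 1
blk-rim p a a<μ = cong (if_then 1 else 2) (≤ᵇ-≤ a<μ)

loc-rim : (p a : ℕ) → a < μ p → loc (order p) (suc a) ≡ a
loc-rim p a a<μ = cong (if_then a else suc a ∸ order p) (≤ᵇ-≤ a<μ)

μ<μ+a+1 : (p a : ℕ) → μ p < suc (μ p ℕ.+ a)
μ<μ+a+1 p a = s≤s (NP.m≤m+n (μ p) a)

blk-pendant : (p a : ℕ) → blk (order p) (suc (μ p ℕ.+ a)) ≡ 2
blk-pendant p a = cong (if_then 1 else 2) (≤ᵇ-> (μ<μ+a+1 p a))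

loc-pendant : (p a : ℕ) → loc (order p) (suc (μ p ℕ.+ a)) ≡ a
loc-pendant p a = trans (cong (if_then μ p ℕ.+ a else suc (μ p ℕ.+ a) ∸ order p) (≤ᵇ-> (μ<μ+a+1 p a))) (NP.m+n∸m≡n (μ p) a)

module _ (p : ℕ) where
  private
    n m : ℕ
    n = order p
    m = μ p

  L-hub-rim : (b : ℕ) → b < m → Lentry n 0 (suc b) ≡ ½ * - 1ℚ + 0ℚ
  L-hub-rim b b<m = Lentry-blockEntry p 0 (suc b) refl (blk-rim p b b<m) refl (loc-rim p b b<m)

  L-hub-pendant : (b : ℕ) → Lentry n 0 (suc (m ℕ.+ b)) ≡ ½ * 0ℚ + 0ℚ
  L-hub-pendant b = Lentry-blockEntry p 0 (suc (m ℕ.+ b)) refl (blk-pendant p b) refl (loc-pendant p b)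

  L-rim-hub : (a : ℕ) → a < m → Lentry n (suc a) 0 ≡ ½ * - 1ℚ + 0ℚ
  L-rim-hub a a<m = Lentry-blockEntry p (suc a) 0 (blk-rim p a a<m) refl (loc-rim p a a<m) refl

  L-rim-rim : (a b : ℕ) → a < m → b < m → Lentry n (suc a) (suc b) ≡ ½ * (ℕtoℚ (suc n) * δ a b) + circSum n a b
  L-rim-rim a b a<m b<m = Lentry-blockEntry p (suc a) (suc b) (blk-rim p a a<m) (blk-rim p b b<m) (loc-rim p a a<m) (loc-rim p b b<m)

  L-rim-pendant : (a b : ℕ) → a < m → Lentry n (suc a) (suc (m ℕ.+ b)) ≡ ½ * (ℤtoℚ (ℤ.- ℤ.+ 2) * δ a b) + 0ℚ
  L-rim-pendant a b a<m = Lentry-blockEntry p (suc a) (suc (m ℕ.+ b)) (blk-rim p a a<m) (blk-pendant p b) (loc-rim p a a<m) (loc-pendant p b)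

  L-pendant-hub : (a : ℕ) → Lentry n (suc (m ℕ.+ a)) 0 ≡ ½ * 0ℚ + 0ℚ
  L-pendant-hub a = Lentry-blockEntry p (suc (m ℕ.+ a)) 0 (blk-pendant p a) refl (loc-pendant p a) refl

  L-pendant-rim : (a b : ℕ) → b < m → Lentry n (suc (m ℕ.+ a)) (suc b) ≡ ½ * (ℤtoℚ (ℤ.- ℤ.+ 2) * δ a b) + 0ℚ
  L-pendant-rim a b b<m = Lentry-blockEntry p (suc (m ℕ.+ a)) (suc b) (blk-pendant p a) (blk-rim p b b<m) (loc-pendant p a) (loc-rim p b b<m)

  L-pendant-pendant : (a b : ℕ) → Lentry n (suc (m ℕ.+ a)) (suc (m ℕ.+ b)) ≡ ½ * (ℕtoℚ 2 * δ a b) + 0ℚ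
  L-pendant-pendant a b = Lentry-blockEntry p (suc (m ℕ.+ a)) (suc (m ℕ.+ b)) (blk-pendant p a) (blk-pendant p b) (loc-pendant p a) (loc-pendant p b)

  L-rim-rim≡circCoeff : (a b : ℕ) → a < m → b < m → Lentry n (suc a) (suc b) ≡ circCoeff m ∣ a - b ∣ + δ a b
  L-rim-rim≡circCoeff a b a<m b<m = begin
      Lentry n (suc a) (suc b)
    ≡⟨ L-rim-rim a b a<m b<m ⟩
      ½ * (ℕtoℚ (suc n) * δ a b) + circSum n a b
    ≡⟨ cong₂ (λ u v → ½ * (u * δ a b) + v) (trans (ℕtoℚ-suc (suc m)) (cong (1ℚ +_) (ℕtoℚ-suc m))) (circSum≡ p a b a<m b<m) ⟩
      ½ * ((1ℚ + (1ℚ + ℕtoℚ m)) * δ a b) + (circCoeff m ∣ a - b ∣ + - circCoeff m 0 * δ a b)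
    ≡⟨ cong (λ c → ½ * ((1ℚ + (1ℚ + ℕtoℚ m)) * δ a b) + (circCoeff m ∣ a - b ∣ + - c * δ a b)) (circCoeff-zero m) ⟩
      ½ * ((1ℚ + (1ℚ + ℕtoℚ m)) * δ a b) + (circCoeff m ∣ a - b ∣ + - (½ * ℕtoℚ m) * δ a b)
    ≡⟨ solve 3 (λ M d x → con ½ :* ((con 1ℚ :+ (con 1ℚ :+ M)) :* d) :+ (x :+ :- (con ½ :* M) :* d) := x :+ d) refl
         (ℕtoℚ m) (δ a b) (circCoeff m ∣ a - b ∣) ⟩
      circCoeff m ∣ a - b ∣ + δ a b ∎

δ-sym : (a b : ℕ) → δ a b ≡ δ b a
δ-sym a b with a NP.≟ b
... | yes refl = refl
... | no a≢b = trans (δ-≢ a≢b) (sym (δ-≢ (a≢b ∘ sym)))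

L-sym : (p i j : ℕ) → Vertex p i → Vertex p j → Lentry (order p) i j ≡ Lentry (order p) j i
L-sym p .0 .0 hub hub = refl
L-sym p .0 .(suc b) hub (rim b b<μ) = trans (L-hub-rim p b b<μ) (sym (L-rim-hub p b b<μ))
L-sym p .0 .(suc (μ p ℕ.+ b)) hub (pendant b _) = trans (L-hub-pendant p b) (sym (L-pendant-hub p b))
L-sym p .(suc a) .0 (rim a a<μ) hub = trans (L-rim-hub p a a<μ) (sym (L-hub-rim p a a<μ))
L-sym p .(suc a) .(suc b) (rim a a<μ) (rim b b<μ) = begin
  Lentry (order p) (suc a) (suc b)    ≡⟨ L-rim-rim≡circCoeff p a b a<μ b<μ ⟩
  circCoeff (μ p) ∣ a - b ∣ + δ a b   ≡⟨ cong₂ (λ d e → circCoeff (μ p) d + e) (NP.∣-∣-comm a b) (δ-sym a b) ⟩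
  circCoeff (μ p) ∣ b - a ∣ + δ b a   ≡⟨ sym (L-rim-rim≡circCoeff p b a b<μ a<μ) ⟩
  Lentry (order p) (suc b) (suc a)    ∎
L-sym p .(suc a) .(suc (μ p ℕ.+ b)) (rim a a<μ) (pendant b _) = trans (L-rim-pendant p a b a<μ)
  (trans (cong (λ d → ½ * (ℤtoℚ (ℤ.- ℤ.+ 2) * d) + 0ℚ) (δ-sym a b)) (sym (L-pendant-rim p b a a<μ)))
L-sym p .(suc (μ p ℕ.+ a)) .0 (pendant a _) hub = trans (L-pendant-hub p a) (sym (L-hub-pendant p a))
L-sym p .(suc (μ p ℕ.+ a)) .(suc b) (pendant a _) (rim b b<μ) = trans (L-pendant-rim p a b b<μ)
  (trans (cong (λ d → ½ * (ℤtoℚ (ℤ.- ℤ.+ 2) * d) + 0ℚ) (δ-sym a b)) (sym (L-rim-pendant p b a b<μ)))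
L-sym p .(suc (μ p ℕ.+ a)) .(suc (μ p ℕ.+ b)) (pendant a _) (pendant b _) = trans (L-pendant-pendant p a b)
  (trans (cong (λ d → ½ * (ℕtoℚ 2 * d) + 0ℚ) (δ-sym a b)) (sym (L-pendant-pendant p b a)))

sumℕ-δ : (m a : ℕ) (c : ℚ) (f : ℕ → ℚ) → a < m → (∀ b → b < m → f b ≡ c * δ a b) → sumℕ m f ≡ c
sumℕ-δ m a c f a<m f≡cδ = begin
    sumℕ m f              ≡⟨ sumℕ-cong m f≡cδ ⟩
    sumℕ m (λ b → c * δ a b)  ≡⟨ sumℕ-single m (λ b → c * δ a b) a a<m (λ b _ b≢a → trans (cong (c *_) (δ-≢ (b≢a ∘ sym))) (ℚP.*-zeroʳ c)) ⟩
    c * δ a a             ≡⟨ trans (cong (c *_) (δ-≡ a)) (ℚP.*-identityʳ c) ⟩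
    c                     ∎

½*[x*δ]+0 : (x : ℚ) (a b : ℕ) → ½ * (x * δ a b) + 0ℚ ≡ (½ * x) * δ a b
½*[x*δ]+0 x a b = solve 2 (λ x d → con ½ :* (x :* d) :+ con 0ℚ := (con ½ :* x) :* d) refl x (δ a b)

sumℕ-vertices : (p : ℕ) (f : ℕ → ℚ) →
  sumℕ (suc (μ p ℕ.+ μ p)) f ≡ f 0 + (sumℕ (μ p) (f ∘ suc) + sumℕ (μ p) (λ a → f (suc (μ p ℕ.+ a))))
sumℕ-vertices p f = cong (f 0 +_) (sumℕ-split (μ p) (μ p) (f ∘ suc))

module _ (p : ℕ) where
  private
    n m : ℕ
    n = order p
    m = μ p

  L-hub-rowSum : sumℕ (suc (m ℕ.+ m)) (Lentry n 0) ≡ 0ℚ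
  L-hub-rowSum = begin
      sumℕ (suc (m ℕ.+ m)) (Lentry n 0)
    ≡⟨ sumℕ-vertices p (Lentry n 0) ⟩
      (½ * ℕtoℚ m + 0ℚ) + (sumℕ m (λ b → Lentry n 0 (suc b)) + sumℕ m (λ b → Lentry n 0 (suc (m ℕ.+ b))))
    ≡⟨ cong₂ (λ u v → (½ * ℕtoℚ m + 0ℚ) + (u + v))
         (trans (sumℕ-cong m (L-hub-rim p)) (sumℕ-const m (½ * - 1ℚ + 0ℚ)))
         (trans (sumℕ-cong m (λ b _ → L-hub-pendant p b)) (sumℕ-const m (½ * 0ℚ + 0ℚ))) ⟩
      (½ * ℕtoℚ m + 0ℚ) + (ℕtoℚ m * (½ * - 1ℚ + 0ℚ) + ℕtoℚ m * (½ * 0ℚ + 0ℚ))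
    ≡⟨ solve 1 (λ M → (con ½ :* M :+ con 0ℚ) :+ (M :* (con ½ :* :- con 1ℚ :+ con 0ℚ) :+ M :* (con ½ :* con 0ℚ :+ con 0ℚ)) := con 0ℚ) refl (ℕtoℚ m) ⟩
      0ℚ ∎

  L-rim-rowSum : (a : ℕ) → a < m → sumℕ (suc (m ℕ.+ m)) (Lentry n (suc a)) ≡ 0ℚ
  L-rim-rowSum a a<m = begin
      sumℕ (suc (m ℕ.+ m)) (Lentry n (suc a))
    ≡⟨ sumℕ-vertices p (Lentry n (suc a)) ⟩
      Lentry n (suc a) 0 + (sumℕ m (λ b → Lentry n (suc a) (suc b)) + sumℕ m (λ b → Lentry n (suc a) (suc (m ℕ.+ b))))
    ≡⟨ cong₂ _+_ (L-rim-hub p a a<m) (cong₂ _+_ rimPart pendantPart) ⟩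
      (½ * - 1ℚ + 0ℚ) + ((½ + 1ℚ) + ½ * ℤtoℚ (ℤ.- ℤ.+ 2))
    ≡⟨⟩
      0ℚ ∎
    where
    rimPart : sumℕ m (λ b → Lentry n (suc a) (suc b)) ≡ ½ + 1ℚ
    rimPart = begin
        sumℕ m (λ b → Lentry n (suc a) (suc b))
      ≡⟨ sumℕ-cong m (λ b b<m → L-rim-rim≡circCoeff p a b a<m b<m) ⟩
        sumℕ m (λ b → circCoeff m ∣ a - b ∣ + δ a b)
      ≡⟨ sumℕ-+ m (λ b → circCoeff m ∣ a - b ∣) (δ a) ⟩
        sumℕ m (λ b → circCoeff m ∣ a - b ∣) + sumℕ m (δ a)
      ≡⟨ cong₂ _+_ (circCoeff-rowSum p a a<m) (sumℕ-δ m a 1ℚ (δ a) a<m (λ b _ → sym (ℚP.*-identityˡ (δ a b)))) ⟩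
        ½ + 1ℚ ∎
    pendantPart : sumℕ m (λ b → Lentry n (suc a) (suc (m ℕ.+ b))) ≡ ½ * ℤtoℚ (ℤ.- ℤ.+ 2)
    pendantPart = sumℕ-δ m a _ _ a<m (λ b _ → trans (L-rim-pendant p a b a<m) (½*[x*δ]+0 (ℤtoℚ (ℤ.- ℤ.+ 2)) a b))

  L-pendant-rowSum : (a : ℕ) → a < m → sumℕ (suc (m ℕ.+ m)) (Lentry n (suc (m ℕ.+ a))) ≡ 0ℚ
  L-pendant-rowSum a a<m = begin
      sumℕ (suc (m ℕ.+ m)) (Lentry n (suc (m ℕ.+ a)))
    ≡⟨ sumℕ-vertices p (Lentry n (suc (m ℕ.+ a))) ⟩
      Lentry n (suc (m ℕ.+ a)) 0 + (sumℕ m (λ b → Lentry n (suc (m ℕ.+ a)) (suc b)) + sumℕ m (λ b → Lentry n (suc (m ℕ.+ a)) (suc (m ℕ.+ b))))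
    ≡⟨ cong₂ _+_ (L-pendant-hub p a) (cong₂ _+_
         (sumℕ-δ m a _ _ a<m (λ b b<m → trans (L-pendant-rim p a b b<m) (½*[x*δ]+0 (ℤtoℚ (ℤ.- ℤ.+ 2)) a b)))
         (sumℕ-δ m a _ _ a<m (λ b _ → trans (L-pendant-pendant p a b) (½*[x*δ]+0 (ℕtoℚ 2) a b)))) ⟩
      (½ * 0ℚ + 0ℚ) + (½ * ℤtoℚ (ℤ.- ℤ.+ 2) + ½ * ℕtoℚ 2)
    ≡⟨⟩
      0ℚ ∎

L-rowSum : (p i : ℕ) → Vertex p i → sumℕ (suc (μ p ℕ.+ μ p)) (Lentry (order p) i) ≡ 0ℚ
L-rowSum p .0 hub = L-hub-rowSum p
L-rowSum p .(suc a) (rim a a<μ) = L-rim-rowSum p a a<μ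
L-rowSum p .(suc (μ p ℕ.+ a)) (pendant a a<μ) = L-pendant-rowSum p a a<μ

-- The determinant of the rim-pendant block

-- r + s, junk value r when r + s ≥ m (only used for rows r with r + s < m).
shiftFin : (m s : ℕ) → Fin m → Fin m
shiftFin m s r with s ℕ.+ toℕ r NP.<? m
... | yes r+s<m = fromℕ< r+s<m
... | no _ = r

toℕ-shiftFin : (m s : ℕ) (r : Fin m) → s ℕ.+ toℕ r < m → toℕ (shiftFin m s r) ≡ s ℕ.+ toℕ r
toℕ-shiftFin m s r r+s<m with s ℕ.+ toℕ r NP.<? m
... | yes r+s<m′ = FP.toℕ-fromℕ< r+s<m′
... | no r+s≮m = ⊥-elim (r+s≮m r+s<m)

circToeplitz : (p : ℕ) → Matrix (μ p)
circToeplitz p i j = circCoeff (μ p) ∣ toℕ i - toℕ j ∣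

combination : ℕ → ℕ → ℕ → ℕ → ℚ
combination M x y z = circCoeff M x + (ℕtoℚ 2 * circCoeff M y + (1ℚ * circCoeff M z + 0ℚ))

combination-cong : (M : ℕ) {x y z x′ y′ z′ : ℕ} → x ≡ x′ → y ≡ y′ → z ≡ z′ → combination M x y z ≡ combination M x′ y′ z′
combination-cong M refl refl refl = refl

∣m+n-m∣≡n : (m n : ℕ) → ∣ m ℕ.+ n - m ∣ ≡ n
∣m+n-m∣≡n m n = trans (NP.∣-∣-comm (m ℕ.+ n) m) (NP.∣m-m+n∣≡n m n)

∣m-1+m∣≡1 : (m : ℕ) → ∣ m - suc m ∣ ≡ 1
∣m-1+m∣≡1 m = trans (cong (λ w → ∣ m - w ∣) (NP.+-comm 1 m)) (NP.∣m-m+n∣≡n m 1)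

combination-rows : (M r q : ℕ) → combination M ∣ r - q ∣ ∣ suc r - q ∣ ∣ suc (suc r) - q ∣ ≡ ℕtoℚ 2 * δ q (suc r)
combination-rows M r q with NP.<-cmp q (suc r)
... | tri< q<r+1 _ _ = subst (λ x → combination M ∣ x - q ∣ ∣ suc x - q ∣ ∣ suc (suc x) - q ∣ ≡ ℕtoℚ 2 * δ q (suc x))
    (NP.m+[n∸m]≡n (ℕ.s≤s⁻¹ q<r+1)) (below (r ∸ q))
  where
  below : ∀ d → combination M ∣ q ℕ.+ d - q ∣ ∣ suc (q ℕ.+ d) - q ∣ ∣ suc (suc (q ℕ.+ d)) - q ∣ ≡ ℕtoℚ 2 * δ q (suc (q ℕ.+ d))
  below d = begin
      combination M ∣ q ℕ.+ d - q ∣ ∣ suc (q ℕ.+ d) - q ∣ ∣ suc (suc (q ℕ.+ d)) - q ∣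
    ≡⟨ combination-cong M (∣m+n-m∣≡n q d)
         (trans (cong (λ w → ∣ w - q ∣) (sym (NP.+-suc q d))) (∣m+n-m∣≡n q (suc d)))
         (trans (cong (λ w → ∣ w - q ∣) (trans (cong suc (sym (NP.+-suc q d))) (sym (NP.+-suc q (suc d))))) (∣m+n-m∣≡n q (suc (suc d)))) ⟩
      combination M d (suc d) (suc (suc d))
    ≡⟨ circCoeff-recurrence M d ⟩
      0ℚ
    ≡⟨ sym (trans (cong (ℕtoℚ 2 *_) (δ-≢ (NP.m≢1+m+n q))) (ℚP.*-zeroʳ (ℕtoℚ 2))) ⟩
      ℕtoℚ 2 * δ q (suc (q ℕ.+ d)) ∎
... | tri≈ _ refl _ = begin
    combination M ∣ r - suc r ∣ ∣ suc r - suc r ∣ ∣ suc r - r ∣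
  ≡⟨ combination-cong M (∣m-1+m∣≡1 r) (NP.∣n-n∣≡0 r) (trans (NP.∣-∣-comm (suc r) r) (∣m-1+m∣≡1 r)) ⟩
    combination M 1 0 1
  ≡⟨ circCoeff-centre M ⟩
    ℕtoℚ 2
  ≡⟨ sym (trans (cong (ℕtoℚ 2 *_) (δ-≡ (suc r))) (ℚP.*-identityʳ (ℕtoℚ 2))) ⟩
    ℕtoℚ 2 * δ (suc r) (suc r) ∎
... | tri> _ _ r+1<q = subst (λ x → combination M ∣ r - x ∣ ∣ suc r - x ∣ ∣ suc (suc r) - x ∣ ≡ ℕtoℚ 2 * δ x (suc r))
    (NP.m+[n∸m]≡n r+1<q) (above (q ∸ suc (suc r)))
  where
  above : ∀ d → combination M ∣ r - suc (suc r) ℕ.+ d ∣ ∣ r - suc r ℕ.+ d ∣ ∣ r - r ℕ.+ d ∣ ≡ ℕtoℚ 2 * δ (suc (suc (r ℕ.+ d))) (suc r)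
  above d = begin
      combination M ∣ r - suc (suc r) ℕ.+ d ∣ ∣ r - suc r ℕ.+ d ∣ ∣ r - r ℕ.+ d ∣
    ≡⟨ combination-cong M
         (trans (cong (λ w → ∣ r - w ∣) (trans (cong suc (sym (NP.+-suc r d))) (sym (NP.+-suc r (suc d))))) (NP.∣m-m+n∣≡n r (suc (suc d))))
         (trans (cong (λ w → ∣ r - w ∣) (sym (NP.+-suc r d))) (NP.∣m-m+n∣≡n r (suc d)))
         (NP.∣m-m+n∣≡n r d) ⟩
      combination M (suc (suc d)) (suc d) d
    ≡⟨ solve 4 (λ a b c t → a :+ (t :* b :+ (con 1ℚ :* c :+ con 0ℚ)) := c :+ (t :* b :+ (con 1ℚ :* a :+ con 0ℚ))) refl
         (circCoeff M (suc (suc d))) (circCoeff M (suc d)) (circCoeff M d) (ℕtoℚ 2) ⟩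
      combination M d (suc d) (suc (suc d))
    ≡⟨ circCoeff-recurrence M d ⟩
      0ℚ
    ≡⟨ sym (trans (cong (ℕtoℚ 2 *_) (δ-≢ (NP.m≢1+m+n r ∘ sym ∘ NP.suc-injective))) (ℚP.*-zeroʳ (ℕtoℚ 2))) ⟩
      ℕtoℚ 2 * δ (suc (suc (r ℕ.+ d))) (suc r) ∎

module ToeplitzElimination (p : ℕ) where
  M K : ℕ
  M = μ p
  K = suc (p ℕ.* 2)
  E : Matrix M
  E = circToeplitz p
  g : Fin M → Fin 2 → Fin M
  g r fzero = shiftFin M 1 r
  g r (fsuc _) = shiftFin M 2 r
  c : Fin M → Fin 2 → ℚ
  c r fzero = ℕtoℚ 2
  c r (fsuc _) = 1ℚ
  X : Matrix M
  X r j = E r j + sumFin 2 (λ k → c r k * E (g r k) j)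
  B : Matrix M
  B = spliceRows K X E
  r₁ r₂ : Fin M
  r₁ = inject₁ (fromℕ K)
  r₂ = fromℕ (suc K)
  shift₁ : (r : Fin M) → toℕ r < K → toℕ (shiftFin M 1 r) ≡ suc (toℕ r)
  shift₁ r r<K = toℕ-shiftFin M 1 r (NP.m<n⇒m<1+n (s≤s r<K))
  shift₂ : (r : Fin M) → toℕ r < K → toℕ (shiftFin M 2 r) ≡ suc (suc (toℕ r))
  shift₂ r r<K = toℕ-shiftFin M 2 r (s≤s (s≤s r<K))
  g-later : ∀ r k → toℕ r < K → toℕ r < toℕ (g r k)
  g-later r fzero r<K = NP.≤-reflexive (sym (shift₁ r r<K))
  g-later r (fsuc _) r<K = NP.<-≤-trans (NP.m<n⇒m<1+n (NP.n<1+n (toℕ r))) (NP.≤-reflexive (sym (shift₂ r r<K)))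
  rowsOfB : ∀ r q → toℕ r < K → B r q ≡ ℕtoℚ 2 * δ (toℕ q) (suc (toℕ r))
  rowsOfB r q r<K = trans (spliceRows-< K X E r q r<K)
    (trans (cong₂ (λ u v → combination M ∣ toℕ r - toℕ q ∣ ∣ u - toℕ q ∣ ∣ v - toℕ q ∣) (shift₁ r r<K) (shift₂ r r<K))
      (combination-rows M (toℕ r) (toℕ q)))
  r₁≡K : toℕ r₁ ≡ K
  r₁≡K = trans (FP.toℕ-inject₁ (fromℕ K)) (FP.toℕ-fromℕ K)
  r₂≡K+1 : toℕ r₂ ≡ suc K
  r₂≡K+1 = FP.toℕ-fromℕ (suc K)
  B≡E-r₁ : ∀ j → B r₁ j ≡ E r₁ j
  B≡E-r₁ j = spliceRows-≥ K X E r₁ j (NP.≤-reflexive (sym r₁≡K))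
  B≡E-r₂ : ∀ j → B r₂ j ≡ E r₂ j
  B≡E-r₂ j = spliceRows-≥ K X E r₂ j (NP.≤-trans (NP.n≤1+n K) (NP.≤-reflexive (sym r₂≡K+1)))
  corner : B r₁ fzero * B r₂ r₂ + - (B r₁ r₂ * B r₂ fzero) ≡ - 1ℚ
  corner = begin
      B r₁ fzero * B r₂ r₂ + - (B r₁ r₂ * B r₂ fzero)
    ≡⟨ cong₂ (λ u v → u * v + - (B r₁ r₂ * B r₂ fzero)) (B≡E-r₁ fzero) (B≡E-r₂ r₂) ⟩
      E r₁ fzero * E r₂ r₂ + - (B r₁ r₂ * B r₂ fzero)
    ≡⟨ cong₂ (λ u v → E r₁ fzero * E r₂ r₂ + - (u * v)) (B≡E-r₁ r₂) (B≡E-r₂ fzero) ⟩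
      E r₁ fzero * E r₂ r₂ + - (E r₁ r₂ * E r₂ fzero)
    ≡⟨ cong₂ (λ a b → circCoeff M ∣ a - 0 ∣ * circCoeff M ∣ b - b ∣ + - (circCoeff M ∣ a - b ∣ * circCoeff M ∣ b - 0 ∣)) r₁≡K r₂≡K+1 ⟩
      circCoeff M K * circCoeff M ∣ suc K - suc K ∣ + - (circCoeff M ∣ K - suc K ∣ * circCoeff M (suc K))
    ≡⟨ cong₂ (λ a b → circCoeff M K * circCoeff M a + - (circCoeff M b * circCoeff M (suc K))) (NP.∣n-n∣≡0 (suc K)) (∣m-1+m∣≡1 K) ⟩
      circCoeff M K * circCoeff M 0 + - (circCoeff M 1 * circCoeff M (suc K))
    ≡⟨ circCoeff-corner p ⟩
      - 1ℚ ∎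

det-circToeplitz : (p : ℕ) → det (μ p) (circToeplitz p) ≡ ℕtoℚ (2 ^ suc (p ℕ.* 2))
det-circToeplitz p = begin
    det M E
  ≡⟨ sym (det-addLaterRows M 2 K g c E B g-later (spliceRows-< K X E) (spliceRows-≥ K X E)) ⟩
    det M B
  ≡⟨ det-shiftedRows 2 K B rowsOfB ⟩
    (sign K * ℕtoℚ (2 ^ K)) * (B r₁ fzero * B r₂ r₂ + - (B r₁ r₂ * B r₂ fzero))
  ≡⟨ cong ((sign K * ℕtoℚ (2 ^ K)) *_) corner ⟩
    (sign K * ℕtoℚ (2 ^ K)) * - 1ℚ
  ≡⟨ cong (λ s → (- s * ℕtoℚ (2 ^ K)) * - 1ℚ) (sign-*2 p) ⟩
    (- 1ℚ * ℕtoℚ (2 ^ K)) * - 1ℚ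
  ≡⟨ solve 1 (λ x → (:- con 1ℚ :* x) :* :- con 1ℚ := x) refl (ℕtoℚ (2 ^ K)) ⟩
    ℕtoℚ (2 ^ K) ∎
  where
  open ToeplitzElimination p

rimPendantBlock : (p : ℕ) → Matrix (μ p ℕ.+ μ p)
rimPendantBlock p i j = Lentry (order p) (suc (toℕ i)) (suc (toℕ j))

-- Adding each pendant row to its rim row makes the block lower triangular, with diagonal blocks
-- circToeplitz p and the identity.
module RimPendantElimination (p : ℕ) where
  M : ℕ
  M = μ p
  A : Matrix (M ℕ.+ M)
  A = rimPendantBlock p
  g : Fin (M ℕ.+ M) → Fin 1 → Fin (M ℕ.+ M)
  g r _ = shiftFin (M ℕ.+ M) M r
  X : Matrix (M ℕ.+ M)
  X r j = A r j + sumFin 1 (λ k → 1ℚ * A (g r k) j)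
  B : Matrix (M ℕ.+ M)
  B = spliceRows M X A
  toℕ-g : (r : Fin (M ℕ.+ M)) → toℕ r < M → toℕ (g r fzero) ≡ M ℕ.+ toℕ r
  toℕ-g r r<M = toℕ-shiftFin (M ℕ.+ M) M r (NP.+-monoʳ-< M r<M)
  g-later : ∀ r k → toℕ r < M → toℕ r < toℕ (g r k)
  g-later r fzero r<M = NP.<-≤-trans r<M (NP.≤-trans (NP.m≤m+n M (toℕ r)) (NP.≤-reflexive (sym (toℕ-g r r<M))))
  i↑ˡ<M : (i : Fin M) → toℕ (i ↑ˡ M) < M
  i↑ˡ<M i = NP.≤-trans (NP.≤-reflexive (cong suc (FP.toℕ-↑ˡ i M))) (FP.toℕ<n i)
  rimRow : (i : Fin M) (j : ℕ) (j′ : Fin (M ℕ.+ M)) → toℕ j′ ≡ j →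
    B (i ↑ˡ M) j′ ≡ Lentry (order p) (suc (toℕ i)) (suc j) + (1ℚ * Lentry (order p) (suc (M ℕ.+ toℕ i)) (suc j) + 0ℚ)
  rimRow i j j′ refl = trans (spliceRows-< M X A (i ↑ˡ M) j′ (i↑ˡ<M i))
    (cong₂ (λ a b → Lentry (order p) (suc a) (suc (toℕ j′)) + (1ℚ * Lentry (order p) (suc b) (suc (toℕ j′)) + 0ℚ))
      (FP.toℕ-↑ˡ i M) (trans (toℕ-g (i ↑ˡ M) (i↑ˡ<M i)) (cong (M ℕ.+_) (FP.toℕ-↑ˡ i M))))
  upperRight : ∀ i j → B (i ↑ˡ M) (M ↑ʳ j) ≡ 0ℚ
  upperRight i j = begin
      B (i ↑ˡ M) (M ↑ʳ j)
    ≡⟨ rimRow i (M ℕ.+ toℕ j) (M ↑ʳ j) (FP.toℕ-↑ʳ M j) ⟩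
      Lentry (order p) (suc (toℕ i)) (suc (M ℕ.+ toℕ j)) + (1ℚ * Lentry (order p) (suc (M ℕ.+ toℕ i)) (suc (M ℕ.+ toℕ j)) + 0ℚ)
    ≡⟨ cong₂ (λ u v → u + (1ℚ * v + 0ℚ)) (L-rim-pendant p (toℕ i) (toℕ j) (FP.toℕ<n i)) (L-pendant-pendant p (toℕ i) (toℕ j)) ⟩
      (½ * (ℤtoℚ (ℤ.- ℤ.+ 2) * δ (toℕ i) (toℕ j)) + 0ℚ) + (1ℚ * (½ * (ℕtoℚ 2 * δ (toℕ i) (toℕ j)) + 0ℚ) + 0ℚ)
    ≡⟨ solve 1 (λ d → (con ½ :* (con (ℤtoℚ (ℤ.- ℤ.+ 2)) :* d) :+ con 0ℚ) :+ (con 1ℚ :* (con ½ :* (con (ℕtoℚ 2) :* d) :+ con 0ℚ) :+ con 0ℚ)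
                      := con 0ℚ) refl (δ (toℕ i) (toℕ j)) ⟩
      0ℚ ∎
  upperLeft : ∀ i j → B (i ↑ˡ M) (j ↑ˡ M) ≡ circToeplitz p i j
  upperLeft i j = begin
      B (i ↑ˡ M) (j ↑ˡ M)
    ≡⟨ rimRow i (toℕ j) (j ↑ˡ M) (FP.toℕ-↑ˡ j M) ⟩
      Lentry (order p) (suc a) (suc b) + (1ℚ * Lentry (order p) (suc (M ℕ.+ a)) (suc b) + 0ℚ)
    ≡⟨ cong₂ (λ u v → u + (1ℚ * v + 0ℚ)) (L-rim-rim≡circCoeff p a b (FP.toℕ<n i) (FP.toℕ<n j)) (L-pendant-rim p a b (FP.toℕ<n j)) ⟩
      (circCoeff M ∣ a - b ∣ + δ a b) + (1ℚ * (½ * (ℤtoℚ (ℤ.- ℤ.+ 2) * δ a b) + 0ℚ) + 0ℚ)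
    ≡⟨ solve 2 (λ x d → (x :+ d) :+ (con 1ℚ :* (con ½ :* (con (ℤtoℚ (ℤ.- ℤ.+ 2)) :* d) :+ con 0ℚ) :+ con 0ℚ) := x) refl
         (circCoeff M ∣ a - b ∣) (δ a b) ⟩
      circToeplitz p i j ∎
    where
    a = toℕ i
    b = toℕ j
  lowerRight : ∀ i j → B (M ↑ʳ i) (M ↑ʳ j) ≡ δ (toℕ i) (toℕ j)
  lowerRight i j = begin
      B (M ↑ʳ i) (M ↑ʳ j)
    ≡⟨ spliceRows-≥ M X A (M ↑ʳ i) (M ↑ʳ j) (NP.≤-trans (NP.m≤m+n M (toℕ i)) (NP.≤-reflexive (sym (FP.toℕ-↑ʳ M i)))) ⟩
      Lentry (order p) (suc (toℕ (M ↑ʳ i))) (suc (toℕ (M ↑ʳ j)))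
    ≡⟨ cong₂ (λ a b → Lentry (order p) (suc a) (suc b)) (FP.toℕ-↑ʳ M i) (FP.toℕ-↑ʳ M j) ⟩
      Lentry (order p) (suc (M ℕ.+ toℕ i)) (suc (M ℕ.+ toℕ j))
    ≡⟨ L-pendant-pendant p (toℕ i) (toℕ j) ⟩
      ½ * (ℕtoℚ 2 * δ (toℕ i) (toℕ j)) + 0ℚ
    ≡⟨ solve 1 (λ d → con ½ :* (con (ℕtoℚ 2) :* d) :+ con 0ℚ := d) refl (δ (toℕ i) (toℕ j)) ⟩
      δ (toℕ i) (toℕ j) ∎

det-rimPendantBlock : (p : ℕ) → det (μ p ℕ.+ μ p) (rimPendantBlock p) ≡ ℕtoℚ (2 ^ suc (p ℕ.* 2))
det-rimPendantBlock p = begin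
    det (M ℕ.+ M) A
  ≡⟨ sym (det-addLaterRows (M ℕ.+ M) 1 M g (λ _ _ → 1ℚ) A B g-later (spliceRows-< M X A) (spliceRows-≥ M X A)) ⟩
    det (M ℕ.+ M) B
  ≡⟨ det-blockLowerTriangular M M B upperRight ⟩
    det M (λ i j → B (i ↑ˡ M) (j ↑ˡ M)) * det M (λ i j → B (M ↑ʳ i) (M ↑ʳ j))
  ≡⟨ cong₂ _*_ (det-cong M upperLeft) (det-identity M _ lowerRight) ⟩
    det M (circToeplitz p) * 1ℚ
  ≡⟨ trans (ℚP.*-identityʳ _) (det-circToeplitz p) ⟩
    ℕtoℚ (2 ^ suc (p ℕ.* 2)) ∎
  where
  open RimPendantElimination p

size≡ : (p : ℕ) → 2 ℕ.* order p ∸ 1 ≡ suc (μ p ℕ.+ μ p)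
size≡ p = cong (λ x → suc (suc (suc x))) (trans (cong (p ℕ.* 2 ℕ.+_) (NP.+-identityʳ (suc (μ p)))) (NP.+-suc (p ℕ.* 2) (μ p)))

module _ (p : ℕ) where
  private
    m : ℕ
    m = 2 ℕ.* order p ∸ 1
    L : Matrix m
    L = specialLaplacian (order p)

  vertexFin : (i : Fin m) → Vertex p (toℕ i)
  vertexFin i = vertex p (toℕ i) (subst (toℕ i <_) (size≡ p) (FP.toℕ<n i))

  specialLaplacian-sym : Symmetric L
  specialLaplacian-sym i j = L-sym p (toℕ i) (toℕ j) (vertexFin i) (vertexFin j)

  specialLaplacian-columnSums : ColumnSumsZero L
  specialLaplacian-columnSums c = begin
      sumFin m (λ r → L r c)
    ≡⟨ sumFin-toℕ m (λ r → Lentry (order p) r (toℕ c)) ⟩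
      sumℕ m (λ r → Lentry (order p) r (toℕ c))
    ≡⟨ cong (λ k → sumℕ k (λ r → Lentry (order p) r (toℕ c))) (size≡ p) ⟩
      sumℕ (suc (μ p ℕ.+ μ p)) (λ r → Lentry (order p) r (toℕ c))
    ≡⟨ sumℕ-cong _ (λ r r<m → L-sym p r (toℕ c) (vertex p r r<m) (vertexFin c)) ⟩
      sumℕ (suc (μ p ℕ.+ μ p)) (Lentry (order p) (toℕ c))
    ≡⟨ L-rowSum p (toℕ c) (vertexFin c) ⟩
      0ℚ ∎

  cofactor₀₀-specialLaplacian : cofactor m L fzero fzero ≡ ℕtoℚ (2 ^ suc (p ℕ.* 2))
  cofactor₀₀-specialLaplacian = begin
      1ℚ * det (2 ℕ.* order p ∸ 1 ∸ 1) (λ a b → Lentry (order p) (suc (toℕ a)) (suc (toℕ b)))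
    ≡⟨ ℚP.*-identityˡ _ ⟩
      det (2 ℕ.* order p ∸ 1 ∸ 1) (λ a b → Lentry (order p) (suc (toℕ a)) (suc (toℕ b)))
    ≡⟨ cong (λ k → det k (λ a b → Lentry (order p) (suc (toℕ a)) (suc (toℕ b)))) (NP.suc-injective (size≡ p)) ⟩
      det (μ p ℕ.+ μ p) (rimPendantBlock p)
    ≡⟨ det-rimPendantBlock p ⟩
      ℕtoℚ (2 ^ suc (p ℕ.* 2)) ∎

mainTheorem5 : (n : ℕ) → 4 ≤ n → 2 ∣ n →
    (i j : Fin (2 ℕ.* n ∸ 1)) →
    cofactor (2 ℕ.* n ∸ 1) (specialLaplacian n) i j ≡ ℤtoℚ (ℤ.+ (2 ^ (n ∸ 3)))
mainTheorem5 .(zero ℕ.* 2) () (divides zero refl)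
mainTheorem5 .(1 ℕ.* 2) (s≤s (s≤s ())) (divides 1 refl)
mainTheorem5 .(order p) _ (divides (suc (suc p)) refl) i j = begin
  cofactor m L i j          ≡⟨ cofactor≡cofactor₀₀ _ L (specialLaplacian-sym p) (specialLaplacian-columnSums p) i j ⟩
  cofactor m L fzero fzero  ≡⟨ cofactor₀₀-specialLaplacian p ⟩
  ℕtoℚ (2 ^ suc (p ℕ.* 2))  ∎
  where
  m = 2 ℕ.* order p ∸ 1
  L = specialLaplacian (order p)
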